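{- Let $P$ be a finite poset and $C=\{c_1\prec\cdots\prec c_k\}$ a longest chain of $P$. With the notation below, $q'''\le 96\left(\sum_{i=0}^{k} t''_i + \sum_{i=0}^{k} n_i\right)$.
   Context: $P$ is a finite partially ordered set with order $\preceq$. Add virtual elements $c_0,c_{k+1}$ with $c_0\prec u\prec c_{k+1}$ for all $u\in P$. For $i\in\{0,\dots,k\}$, $P_i$ is the subposet of all $u\in P$ with $u\not\preceq c_i$ and $u\not\succeq c_{i+1}$, and $n_i=|P_i|$. An incomparable pair is a 2-element antichain; a 3-antichain is a set of three pairwise incomparable elements. $Q'''$ is the set of incomparable pairs $\{u,v\}$ with $u,v\in P\setminus C$ such that no element of $C$ is incomparable to both $u$ and $v$; $q'''=|Q'''|$. $T''$ is the set of 3-antichains contained in $P\setminus C$ for which some element of $C$ is incomparable to all three elements. For $i\in\{0,\dots,k\}$, $T''_i$ is the set of elements of $T''$ contained in $P_i$, and $t''_i=|T''_i|$. -}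

module Defs where

open import Level using (0ℓ)
open import Data.Nat using (ℕ; zero; suc; _+_; _≤_)
open import Data.Nat.Properties using () renaming (_<?_ to _<ℕ?_)
open import Data.Fin using (Fin; zero; suc; toℕ; fromℕ<) renaming (_<_ to _<ᶠ_)
open import Data.Fin.Properties using (_≟_) renaming (_<?_ to _<ᶠ?_)
open import Data.Bool using (Bool; true; false; _∧_; _∨_; not; if_then_else_)
open import Data.Product using (_×_)
open import Relation.Binary using (Rel; Decidable)
open import Relation.Binary.PropositionalEquality using (_≡_; _≢_)
open import Relation.Nullary using (yes; no)
open import Relation.Nullary.Decidable using (⌊_⌋)

sumᶠ : ∀ m → (Fin m → ℕ) → ℕ
sumᶠ zero f = 0
sumᶠ (suc m) f = f zero + sumᶠ m (λ i → f (suc i))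

countᶠ : ∀ m → (Fin m → Bool) → ℕ
countᶠ m p = sumᶠ m (λ i → if p i then 1 else 0)

anyᶠ : ∀ m → (Fin m → Bool) → Bool
anyᶠ zero p = false
anyᶠ (suc m) p = p zero ∨ anyᶠ m (λ i → p (suc i))

module _ {n : ℕ} (_≼_ : Rel (Fin n) 0ℓ) where

  _≺_ : Rel (Fin n) 0ℓ
  x ≺ y = (x ≼ y) × (x ≢ y)

  IsChain : ∀ {m} → (Fin m → Fin n) → Set
  IsChain {m} c = ∀ (i j : Fin m) → i <ᶠ j → c i ≺ c j

  IsLongestChain : (k : ℕ) → (Fin k → Fin n) → Set
  IsLongestChain k c = IsChain c × (∀ (m : ℕ) (d : Fin m → Fin n) → IsChain d → m ≤ k)

-- The counted quantities, for a chain C = {c_1 ≺ ... ≺ c_k} given as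
-- c : Fin k → Fin n with c j = c_{j+1}.
module Counts {n : ℕ} {_≼_ : Rel (Fin n) 0ℓ} (_≼?_ : Decidable _≼_)
              {k : ℕ} (c : Fin k → Fin n) where

  le : Fin n → Fin n → Bool
  le u v = ⌊ u ≼? v ⌋

  inc : Fin n → Fin n → Bool
  inc u v = not (le u v) ∧ not (le v u)

  inC : Fin n → Bool
  inC u = anyᶠ k (λ j → ⌊ c j ≟ u ⌋)

  outC : Fin n → Bool
  outC u = not (inC u)

  -- u ⋠ c_i   (always true for the virtual bottom c_0)
  lowOK : Fin (suc k) → Fin n → Bool
  lowOK zero u = true
  lowOK (suc j) u = not (le u (c j))

  -- u ⋡ c_{i+1} (always true for the virtual top c_{k+1})
  highOK : Fin (suc k) → Fin n → Bool
  highOK i u with toℕ i <ℕ? k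
  ... | yes p = not (le (c (fromℕ< p)) u)
  ... | no _ = true

  inP : Fin (suc k) → Fin n → Bool
  inP i u = lowOK i u ∧ highOK i u

  nᵢ : Fin (suc k) → ℕ
  nᵢ i = countᶠ n (inP i)

  lt : Fin n → Fin n → Bool
  lt u v = ⌊ u <ᶠ? v ⌋

  -- unordered pairs {u,v} counted as u < v (in the Fin enumeration)
  countPairs : (Fin n → Fin n → Bool) → ℕ
  countPairs p = sumᶠ n (λ u → countᶠ n (λ v → lt u v ∧ p u v))

  -- 3-element subsets {u,v,w} counted as u < v < w
  countTriples : (Fin n → Fin n → Fin n → Bool) → ℕ
  countTriples p = sumᶠ n (λ u → sumᶠ n (λ v → countᶠ n (λ w →
                     lt u v ∧ lt v w ∧ p u v w)))

  isQ''' : Fin n → Fin n → Bool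
  isQ''' u v = outC u ∧ outC v ∧ inc u v
               ∧ not (anyᶠ k (λ j → inc (c j) u ∧ inc (c j) v))

  q''' : ℕ
  q''' = countPairs isQ'''

  isT'' : Fin n → Fin n → Fin n → Bool
  isT'' u v w = outC u ∧ outC v ∧ outC w ∧ inc u v ∧ inc u w ∧ inc v w
                ∧ anyᶠ k (λ j → inc (c j) u ∧ inc (c j) v ∧ inc (c j) w)

  t''ᵢ : Fin (suc k) → ℕ
  t''ᵢ i = countTriples (λ u v w → isT'' u v w ∧ inP i u ∧ inP i v ∧ inP i w)

{-# OPTIONS --safe #-}
-- For x ∉ C the chain elements incomparable to x are the c j with lower x ≤ j < upper x, a nonempty
-- interval since C is a longest chain, and x ∈ P i exactly when lower x ≤ i ≤ upper x.  If {u , v} ∈ Q'''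
-- these intervals are disjoint and, as u ∥ v, adjacent: say upper u = lower v = p.  Then u lies in the
-- fibre A p of upper and v in the fibre B p of lower, whence q''' ≤ 2 Σₚ |A p| |B p|
-- ≤ Σₚ (|A p|² + |B p|²).  Grade A p by height, the length of the longest chain above an element inside
-- A p (below it, for B p); each level is an antichain.  Replacing the part of C incomparable to x by a
-- chain through x inside the fibre shows that the s elements of height t all lie in the same t + 1
-- consecutive P i, so this level accounts for (t + 1) (s + s C 3) in Σᵢ nᵢ + Σᵢ t''ᵢ, and distinct fibres
-- account for disjoint parts.  It remains that (Σₜ sₜ)² ≤ 24 Σₜ (t + 1) (sₜ + sₜ C 3) for all sizes sₜ.
module Submission where

open import Defs
open import Data.Bool using (Bool; true; false; _∧_; not; if_then_else_; T)
open import Data.Bool.Properties using (∧-zeroʳ; ∧-assoc; ∧-comm; T-∧)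
open import Data.Empty using (⊥-elim)
open import Data.Fin using (Fin; zero; suc; toℕ; fromℕ<) renaming (_<_ to _<ᶠ_)
open import Data.Fin.Properties using (toℕ-fromℕ<; toℕ<n; toℕ-injective)
  renaming (_<?_ to _<ᶠ?_; _≟_ to _≟ᶠ_; <⇒≢ to <ᶠ⇒≢; <-trans to <ᶠ-trans)
open import Data.List using ([]; _∷_; _++_; length; tabulate; lookup; filter; reverse)
open import Data.List.Membership.Propositional.Properties using (∈-lookup)
open import Data.List.Properties using (length-++; length-reverse; unfold-reverse)
open import Data.List.Relation.Unary.All as All using (All; []; _∷_)
import Data.List.Relation.Unary.All.Properties as All
open import Data.List.Relation.Unary.AllPairs using (AllPairs; []; _∷_)
import Data.List.Relation.Unary.AllPairs.Properties as AllPairs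
open import Data.Nat
open import Data.Nat.Combinatorics using (_C_; nC1≡n; nCk+nC[k+1]≡[n+1]C[k+1])
open import Data.Nat.Properties
open import Algebra.Properties.Semiring.Sum +-*-semiring
  using (sum; ∑-distrib-+; ∑-comm; *-distribˡ-sum; *-distribʳ-sum)
open import Data.Nat.Tactic.RingSolver using (solve-∀)
open import Data.Product using (_×_; _,_; proj₁; proj₂; ∃)
open import Data.Sum using (inj₁; inj₂)
open import Data.Unit using (tt)
open import Function using (_∘_; flip)
open import Function.Bundles using (Equivalence)
open import Level using (0ℓ)
open import Relation.Binary using (Rel; Decidable; Transitive; IsDecPartialOrder)
open import Relation.Binary.PropositionalEquality
open import Relation.Nullary using (¬_; yes; no; contradiction)
open import Relation.Nullary.Decidable
  using (⌊_⌋; isYes≗does; toWitness; fromWitness; toWitnessFalse; fromWitnessFalse; _×-dec_; ¬?)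
import Relation.Unary as U

-- Indicators and finite sums

⟦_⟧ : Bool → ℕ
⟦ b ⟧ = if b then 1 else 0

⟦⟧≤1 : ∀ b → ⟦ b ⟧ ≤ 1
⟦⟧≤1 true = ≤-refl
⟦⟧≤1 false = z≤n

⟦∧⟧≤ʳ : ∀ a b → ⟦ a ∧ b ⟧ ≤ ⟦ b ⟧
⟦∧⟧≤ʳ true b = ≤-refl
⟦∧⟧≤ʳ false b = z≤n

⟦∧⟧ : ∀ a b → ⟦ a ∧ b ⟧ ≡ ⟦ a ⟧ * ⟦ b ⟧
⟦∧⟧ true b = sym (+-identityʳ ⟦ b ⟧)
⟦∧⟧ false b = refl

⟦≡ᵇ⟧*-subst : ∀ a t (φ : ℕ → ℕ) → ⟦ a ≡ᵇ t ⟧ * φ a ≡ ⟦ a ≡ᵇ t ⟧ * φ t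
⟦≡ᵇ⟧*-subst a t φ with a ≡ᵇ t in eq
... | false = refl
... | true = cong (λ x → 1 * φ x) (≡ᵇ⇒≡ a t (subst T (sym eq) tt))

T-∧⁺ : ∀ {a b} → T a → T b → T (a ∧ b)
T-∧⁺ ta tb = Equivalence.from T-∧ (ta , tb)

T-∧⁻ : ∀ {a b} → T (a ∧ b) → T a × T b
T-∧⁻ = Equivalence.to T-∧

T-not⁺ : ∀ {a} → ¬ T a → T (not a)
T-not⁺ {true} ¬ta = ¬ta tt
T-not⁺ {false} _ = tt

T-not⁻ : ∀ {a} → T (not a) → ¬ T a
T-not⁻ {false} _ ()

T⇒⟦⟧≡1 : ∀ {a} → T a → ⟦ a ⟧ ≡ 1
T⇒⟦⟧≡1 {true} _ = refl

sumᶠ≡sum : ∀ m (f : Fin m → ℕ) → sumᶠ m f ≡ sum f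
sumᶠ≡sum zero f = refl
sumᶠ≡sum (suc m) f = cong (f zero +_) (sumᶠ≡sum m (f ∘ suc))

sumᶠ-cong : ∀ m {f g : Fin m → ℕ} → (∀ i → f i ≡ g i) → sumᶠ m f ≡ sumᶠ m g
sumᶠ-cong zero f≗g = refl
sumᶠ-cong (suc m) f≗g = cong₂ _+_ (f≗g zero) (sumᶠ-cong m (f≗g ∘ suc))

sumᶠ-mono-≤ : ∀ m {f g : Fin m → ℕ} → (∀ i → f i ≤ g i) → sumᶠ m f ≤ sumᶠ m g
sumᶠ-mono-≤ zero f≤g = z≤n
sumᶠ-mono-≤ (suc m) f≤g = +-mono-≤ (f≤g zero) (sumᶠ-mono-≤ m (f≤g ∘ suc))

sumᶠ-distrib-+ : ∀ m (f g : Fin m → ℕ) → sumᶠ m (λ i → f i + g i) ≡ sumᶠ m f + sumᶠ m g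
sumᶠ-distrib-+ m f g = begin
  sumᶠ m (λ i → f i + g i) ≡⟨ sumᶠ≡sum m _ ⟩
  sum (λ i → f i + g i)    ≡⟨ ∑-distrib-+ f g ⟩
  sum f + sum g            ≡⟨ cong₂ _+_ (sumᶠ≡sum m f) (sumᶠ≡sum m g) ⟨
  sumᶠ m f + sumᶠ m g      ∎
  where open ≡-Reasoning

sumᶠ-comm : ∀ m p (f : Fin m → Fin p → ℕ) →
            sumᶠ m (λ i → sumᶠ p (f i)) ≡ sumᶠ p (λ j → sumᶠ m (λ i → f i j))
sumᶠ-comm m p f = begin
  sumᶠ m (λ i → sumᶠ p (f i))           ≡⟨ sumᶠ-cong m (λ i → sumᶠ≡sum p (f i)) ⟩
  sumᶠ m (λ i → sum (f i))              ≡⟨ sumᶠ≡sum m _ ⟩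
  sum (λ i → sum (f i))                 ≡⟨ ∑-comm f ⟩
  sum (λ j → sum (λ i → f i j))         ≡⟨ sumᶠ≡sum p _ ⟨
  sumᶠ p (λ j → sum (λ i → f i j))      ≡⟨ sumᶠ-cong p (λ j → sumᶠ≡sum m (λ i → f i j)) ⟨
  sumᶠ p (λ j → sumᶠ m (λ i → f i j))   ∎
  where open ≡-Reasoning

*-distribˡ-sumᶠ : ∀ m x (f : Fin m → ℕ) → x * sumᶠ m f ≡ sumᶠ m (λ i → x * f i)
*-distribˡ-sumᶠ m x f = begin
  x * sumᶠ m f             ≡⟨ cong (x *_) (sumᶠ≡sum m f) ⟩
  x * sum f                ≡⟨ *-distribˡ-sum x f ⟩
  sum (λ i → x * f i)      ≡⟨ sumᶠ≡sum m _ ⟨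
  sumᶠ m (λ i → x * f i)   ∎
  where open ≡-Reasoning

*-distribʳ-sumᶠ : ∀ m x (f : Fin m → ℕ) → sumᶠ m f * x ≡ sumᶠ m (λ i → f i * x)
*-distribʳ-sumᶠ m x f = begin
  sumᶠ m f * x             ≡⟨ cong (_* x) (sumᶠ≡sum m f) ⟩
  sum f * x                ≡⟨ *-distribʳ-sum x f ⟩
  sum (λ i → f i * x)      ≡⟨ sumᶠ≡sum m _ ⟨
  sumᶠ m (λ i → f i * x)   ∎
  where open ≡-Reasoning

sumᶠ-const : ∀ m x → sumᶠ m (λ _ → x) ≡ m * x
sumᶠ-const zero x = refl
sumᶠ-const (suc m) x = cong (x +_) (sumᶠ-const m x)

sumᶠ-zero : ∀ m → sumᶠ m (λ _ → 0) ≡ 0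
sumᶠ-zero m = trans (sumᶠ-const m 0) (*-zeroʳ m)

f≤sumᶠ : ∀ m (f : Fin m → ℕ) i → f i ≤ sumᶠ m f
f≤sumᶠ (suc m) f zero = m≤m+n (f zero) _
f≤sumᶠ (suc m) f (suc i) = ≤-trans (f≤sumᶠ m (f ∘ suc) i) (m≤n+m _ (f zero))

countᶠ≤ : ∀ m (p : Fin m → Bool) → countᶠ m p ≤ m
countᶠ≤ m p = begin
  countᶠ m p          ≤⟨ sumᶠ-mono-≤ m (λ i → ⟦⟧≤1 (p i)) ⟩
  sumᶠ m (λ _ → 1)    ≡⟨ sumᶠ-const m 1 ⟩
  m * 1               ≡⟨ *-identityʳ m ⟩
  m                   ∎
  where open ≤-Reasoning

countᶠ-complement : ∀ m (p : Fin m → Bool) → countᶠ m p + countᶠ m (not ∘ p) ≡ m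
countᶠ-complement m p = begin
  countᶠ m p + countᶠ m (not ∘ p)            ≡⟨ sumᶠ-distrib-+ m _ _ ⟨
  sumᶠ m (λ i → ⟦ p i ⟧ + ⟦ not (p i) ⟧)     ≡⟨ sumᶠ-cong m (λ i → one (p i)) ⟩
  sumᶠ m (λ _ → 1)                          ≡⟨ sumᶠ-const m 1 ⟩
  m * 1                                     ≡⟨ *-identityʳ m ⟩
  m                                         ∎
  where
  open ≡-Reasoning
  one : ∀ b → ⟦ b ⟧ + ⟦ not b ⟧ ≡ 1
  one true = refl
  one false = refl

sumBelow : ℕ → (ℕ → ℕ) → ℕ
sumBelow L φ = sumᶠ L (λ t → φ (toℕ t))

sumBelow-suc : ∀ L (φ : ℕ → ℕ) → sumBelow (suc L) φ ≡ sumBelow L φ + φ L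
sumBelow-suc zero φ = +-comm (φ 0) 0
sumBelow-suc (suc L) φ = begin
  φ 0 + sumBelow (suc L) (φ ∘ suc)      ≡⟨ cong (φ 0 +_) (sumBelow-suc L (φ ∘ suc)) ⟩
  φ 0 + (sumBelow L (φ ∘ suc) + φ (suc L)) ≡⟨ +-assoc (φ 0) _ _ ⟨
  sumBelow (suc L) φ + φ (suc L)         ∎
  where open ≡-Reasoning

sumBelow-mono-≤ : ∀ {s S} (φ : ℕ → ℕ) → s ≤ S → sumBelow s φ ≤ sumBelow S φ
sumBelow-mono-≤ φ z≤n = z≤n
sumBelow-mono-≤ φ (s≤s s≤S) = +-monoʳ-≤ (φ 0) (sumBelow-mono-≤ (φ ∘ suc) s≤S)

sumBelow-⟦≡ᵇ⟧ : ∀ {a L} → a < L → sumBelow L (λ t → ⟦ a ≡ᵇ t ⟧) ≡ 1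
sumBelow-⟦≡ᵇ⟧ {zero} {suc L} _ = cong suc (sumᶠ-zero L)
sumBelow-⟦≡ᵇ⟧ {suc a} {suc L} (s≤s a<L) = sumBelow-⟦≡ᵇ⟧ a<L

sumBelow-unique : ∀ L a (P : ℕ → Bool) b → a < L → (∀ p → T (P p) → T b × a ≡ p) →
                  sumBelow L (λ p → ⟦ P p ⟧) ≤ ⟦ b ⟧
sumBelow-unique L a P b a<L only-a = begin
  sumBelow L (λ p → ⟦ P p ⟧)               ≤⟨ sumᶠ-mono-≤ L (λ p → pointwise (toℕ p)) ⟩
  sumBelow L (λ p → ⟦ b ⟧ * ⟦ a ≡ᵇ p ⟧)    ≡⟨ *-distribˡ-sumᶠ L ⟦ b ⟧ _ ⟨
  ⟦ b ⟧ * sumBelow L (λ p → ⟦ a ≡ᵇ p ⟧)    ≡⟨ cong (⟦ b ⟧ *_) (sumBelow-⟦≡ᵇ⟧ a<L) ⟩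
  ⟦ b ⟧ * 1                               ≡⟨ *-identityʳ ⟦ b ⟧ ⟩
  ⟦ b ⟧                                   ∎
  where
  open ≤-Reasoning
  pointwise : ∀ p → ⟦ P p ⟧ ≤ ⟦ b ⟧ * ⟦ a ≡ᵇ p ⟧
  pointwise p with P p in P≡
  ... | false = z≤n
  ... | true with only-a p (subst T (sym P≡) tt)
  ... | Tb , refl = ≤-reflexive (sym (cong₂ _*_ (T⇒⟦⟧≡1 Tb) (T⇒⟦⟧≡1 (≡⇒≡ᵇ a a refl))))

sumᶠ-by-fibres : ∀ n L (h : Fin n → ℕ) (g : Fin n → ℕ) → (∀ x → L ≤ h x → g x ≡ 0) →
                 sumᶠ n g ≡ sumBelow L (λ t → sumᶠ n (λ x → ⟦ h x ≡ᵇ t ⟧ * g x))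
sumᶠ-by-fibres n L h g vanish = begin
  sumᶠ n g
    ≡⟨ sumᶠ-cong n fibre ⟩
  sumᶠ n (λ x → sumBelow L (λ t → ⟦ h x ≡ᵇ t ⟧) * g x)
    ≡⟨ sumᶠ-cong n (λ x → *-distribʳ-sumᶠ L (g x) _) ⟩
  sumᶠ n (λ x → sumBelow L (λ t → ⟦ h x ≡ᵇ t ⟧ * g x))
    ≡⟨ sumᶠ-comm n L _ ⟩
  sumBelow L (λ t → sumᶠ n (λ x → ⟦ h x ≡ᵇ t ⟧ * g x)) ∎
  where
  open ≡-Reasoning
  fibre : ∀ x → g x ≡ sumBelow L (λ t → ⟦ h x ≡ᵇ t ⟧) * g x
  fibre x with h x <? L
  ... | yes hx<L = sym (trans (cong (_* g x) (sumBelow-⟦≡ᵇ⟧ hx<L)) (*-identityˡ (g x)))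
  ... | no hx≮L rewrite vanish x (≮⇒≥ hx≮L) = sym (*-zeroʳ (sumBelow L (λ t → ⟦ h x ≡ᵇ t ⟧)))

countᶠ-interval : ∀ K lo t (p : Fin K → Bool) → lo + t < K →
                  (∀ i → lo ≤ toℕ i → toℕ i ≤ lo + t → T (p i)) → suc t ≤ countᶠ K p
countᶠ-interval (suc K) (suc lo) t p (s≤s lt) inside =
  ≤-trans (countᶠ-interval K lo t (p ∘ suc) lt (λ i lo≤i i≤hi → inside (suc i) (s≤s lo≤i) (s≤s i≤hi)))
          (m≤n+m _ ⟦ p zero ⟧)
countᶠ-interval (suc K) zero t p (s≤s lt) inside with p zero | inside zero z≤n z≤n
countᶠ-interval (suc K) zero zero p (s≤s lt) inside | true | _ = s≤s z≤n
countᶠ-interval (suc K) zero (suc t) p (s≤s lt) inside | true | _ =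
  s≤s (countᶠ-interval K zero t (p ∘ suc) lt (λ i _ i≤t → inside (suc i) z≤n (s≤s i≤t)))

DownClosed : ∀ {K} → (Fin K → Bool) → Set
DownClosed p = ∀ {i j} → toℕ i ≤ toℕ j → T (p j) → T (p i)

<-countᶠ : ∀ {K} {p : Fin K → Bool} → DownClosed p → ∀ {j} → T (p j) → toℕ j < countᶠ K p
<-countᶠ {K} {p} closed {j} pj =
  countᶠ-interval K 0 (toℕ j) p (toℕ<n j) (λ i _ i≤j → closed i≤j pj)

countᶠ-downClosed : ∀ {K} {p : Fin K → Bool} → DownClosed p → ∀ {j} → toℕ j < countᶠ K p → T (p j)
countᶠ-downClosed {suc K} {p} closed {j} j<count with p zero in p₀
countᶠ-downClosed {suc K} {p} closed {zero} j<count | true = subst T (sym p₀) tt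
countᶠ-downClosed {suc K} {p} closed {suc j} (s≤s j<count) | true =
  countᶠ-downClosed (λ i≤j → closed (s≤s i≤j)) j<count
... | false = contradiction (subst (toℕ j <_) noneAbove j<count) λ ()
  where
  noneAbove : countᶠ K (p ∘ suc) ≡ 0
  noneAbove = trans (sumᶠ-cong K vanish) (sumᶠ-zero K)
    where
    vanish : ∀ i → ⟦ p (suc i) ⟧ ≡ 0
    vanish i with p (suc i) in pᵢ
    ... | false = refl
    ... | true = contradiction (subst T p₀ (closed z≤n (subst T (sym pᵢ) tt))) λ ()

-- Counting triples

triplesIn : ∀ {n} → (Fin n → Bool) → ℕ
triplesIn {n} X = sumᶠ n (λ u → sumᶠ n (λ v → countᶠ n (λ w →
                    ⌊ u <ᶠ? v ⌋ ∧ ⌊ v <ᶠ? w ⌋ ∧ (X u ∧ X v ∧ X w))))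

⟦∧-middle⟧ : ∀ a b c → ⟦ a ∧ (b ∧ c) ⟧ ≡ ⟦ b ⟧ * ⟦ a ∧ c ⟧
⟦∧-middle⟧ true b c = ⟦∧⟧ b c
⟦∧-middle⟧ false b c = sym (*-zeroʳ ⟦ b ⟧)

⟦∧∧-middle⟧ : ∀ a b c d → ⟦ a ∧ b ∧ (c ∧ d) ⟧ ≡ ⟦ c ⟧ * ⟦ a ∧ b ∧ d ⟧
⟦∧∧-middle⟧ true b c d = ⟦∧-middle⟧ b c d
⟦∧∧-middle⟧ false b c d = sym (*-zeroʳ ⟦ c ⟧)

C-step : ∀ b s k → ⟦ b ⟧ * (s C k) + s C suc k ≡ (⟦ b ⟧ + s) C suc k
C-step true s k = trans (cong (_+ s C suc k) (*-identityˡ (s C k))) (nCk+nC[k+1]≡[n+1]C[k+1] s k)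
C-step false s k = refl

private
  lt≡<ᵇ : ∀ {n} (u v : Fin n) → ⌊ u <ᶠ? v ⌋ ≡ (toℕ u <ᵇ toℕ v)
  lt≡<ᵇ u v = isYes≗does (u <ᶠ? v)

  pairsᵇ : ∀ n → (Fin n → Bool) → ℕ
  pairsᵇ n X = sumᶠ n (λ v → countᶠ n (λ w → (toℕ v <ᵇ toℕ w) ∧ (X v ∧ X w)))

  triplesᵇ : ∀ n → (Fin n → Bool) → ℕ
  triplesᵇ n X = sumᶠ n (λ u → sumᶠ n (λ v → countᶠ n (λ w →
                   (toℕ u <ᵇ toℕ v) ∧ (toℕ v <ᵇ toℕ w) ∧ (X u ∧ X v ∧ X w))))

  countᶠ-∧ˡ : ∀ n (b : Bool) (X : Fin n → Bool) → countᶠ n (λ w → b ∧ X w) ≡ ⟦ b ⟧ * countᶠ n X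
  countᶠ-∧ˡ n b X = trans (sumᶠ-cong n (λ w → ⟦∧⟧ b (X w))) (sym (*-distribˡ-sumᶠ n ⟦ b ⟧ _))

  pairsᵇ-C2 : ∀ n X → pairsᵇ n X ≡ countᶠ n X C 2
  pairsᵇ-C2 zero X = refl
  pairsᵇ-C2 (suc n) X = begin
    pairsᵇ (suc n) X
      ≡⟨⟩
    countᶠ n (λ w → X zero ∧ X (suc w)) + pairsᵇ n (X ∘ suc)
      ≡⟨ cong₂ _+_ (countᶠ-∧ˡ n (X zero) (X ∘ suc)) (pairsᵇ-C2 n (X ∘ suc)) ⟩
    ⟦ X zero ⟧ * s + s C 2
      ≡⟨ cong (λ x → ⟦ X zero ⟧ * x + s C 2) (nC1≡n s) ⟨
    ⟦ X zero ⟧ * (s C 1) + s C 2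
      ≡⟨ C-step (X zero) s 1 ⟩
    (⟦ X zero ⟧ + s) C 2 ∎
    where
    open ≡-Reasoning
    s = countᶠ n (X ∘ suc)

  triplesᵇ-C3 : ∀ n X → triplesᵇ n X ≡ countᶠ n X C 3
  triplesᵇ-C3 zero X = refl
  triplesᵇ-C3 (suc n) X = begin
    triplesᵇ (suc n) X
      ≡⟨⟩ -- split off u = 0; the terms with v = 0, or with w = 0 after u, v ≥ 1, vanish
    sumᶠ n (λ _ → 0) + P
      + sumᶠ n (λ u → sumᶠ n (λ _ → 0) + sumᶠ n (λ v → ⟦ (toℕ u <ᵇ toℕ v) ∧ false ⟧ + R u v))
      ≡⟨ cong₂ _+_ (cong (_+ P) (sumᶠ-zero n))
                   (sumᶠ-cong n (λ u → cong₂ _+_ (sumᶠ-zero n)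
                     (sumᶠ-cong n (λ v → cong (λ b → ⟦ b ⟧ + R u v) (∧-zeroʳ (toℕ u <ᵇ toℕ v)))))) ⟩
    P + sumᶠ n (λ u → sumᶠ n (λ v → 0 + R u v))
      ≡⟨⟩
    P + triplesᵇ n (X ∘ suc)
      ≡⟨ cong (_+ triplesᵇ n (X ∘ suc)) pairsAfterZero ⟩
    ⟦ X zero ⟧ * pairsᵇ n (X ∘ suc) + triplesᵇ n (X ∘ suc)
      ≡⟨ cong₂ (λ x y → ⟦ X zero ⟧ * x + y) (pairsᵇ-C2 n (X ∘ suc)) (triplesᵇ-C3 n (X ∘ suc)) ⟩
    ⟦ X zero ⟧ * (s C 2) + s C 3
      ≡⟨ C-step (X zero) s 2 ⟩
    (⟦ X zero ⟧ + s) C 3 ∎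
    where
    open ≡-Reasoning
    s = countᶠ n (X ∘ suc)
    P = sumᶠ n (λ v → countᶠ n (λ w → (toℕ v <ᵇ toℕ w) ∧ (X zero ∧ (X (suc v) ∧ X (suc w)))))
    R : Fin n → Fin n → ℕ
    R u v = countᶠ n (λ w → (toℕ u <ᵇ toℕ v) ∧ (toℕ v <ᵇ toℕ w) ∧ (X (suc u) ∧ X (suc v) ∧ X (suc w)))
    pairsAfterZero : P ≡ ⟦ X zero ⟧ * pairsᵇ n (X ∘ suc)
    pairsAfterZero = begin
      P
        ≡⟨ sumᶠ-cong n (λ v → sumᶠ-cong n (λ w → ⟦∧-middle⟧ (toℕ v <ᵇ toℕ w) (X zero) (X (suc v) ∧ X (suc w)))) ⟩
      sumᶠ n (λ v → sumᶠ n (λ w → ⟦ X zero ⟧ * ⟦ (toℕ v <ᵇ toℕ w) ∧ (X (suc v) ∧ X (suc w)) ⟧))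
        ≡⟨ sumᶠ-cong n (λ v → *-distribˡ-sumᶠ n ⟦ X zero ⟧ _) ⟨
      sumᶠ n (λ v → ⟦ X zero ⟧ * countᶠ n (λ w → (toℕ v <ᵇ toℕ w) ∧ (X (suc v) ∧ X (suc w))))
        ≡⟨ *-distribˡ-sumᶠ n ⟦ X zero ⟧ _ ⟨
      ⟦ X zero ⟧ * pairsᵇ n (X ∘ suc) ∎

triplesIn-C3 : ∀ {n} (X : Fin n → Bool) → triplesIn X ≡ countᶠ n X C 3
triplesIn-C3 {n} X = trans (sumᶠ-cong n λ u → sumᶠ-cong n λ v → sumᶠ-cong n λ w →
                              cong₂ (λ a b → ⟦ a ∧ b ∧ (X u ∧ X v ∧ X w) ⟧) (lt≡<ᵇ u v) (lt≡<ᵇ v w))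
                           (triplesᵇ-C3 n X)

-- Squares of level sizes

private
  2mn≤m²+n²-ordered : ∀ {m n} → m ≤ n → 2 * (m * n) ≤ m * m + n * n
  2mn≤m²+n²-ordered {m} {n} m≤n = subst (λ n → 2 * (m * n) ≤ m * m + n * n) (m+[n∸m]≡n m≤n)
    (≤-trans (m≤m+n _ ((n ∸ m) * (n ∸ m))) (≤-reflexive (expand m (n ∸ m))))
    where
    expand : ∀ m d → 2 * (m * (m + d)) + d * d ≡ m * m + (m + d) * (m + d)
    expand = solve-∀

2mn≤m²+n² : ∀ m n → 2 * (m * n) ≤ m * m + n * n
2mn≤m²+n² m n with ≤-total m n
... | inj₁ m≤n = 2mn≤m²+n²-ordered m≤n
... | inj₂ n≤m = subst₂ _≤_ (cong (2 *_) (*-comm n m)) (+-comm (n * n) (m * m)) (2mn≤m²+n²-ordered n≤m)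

sumBelow-1+C2 : ∀ s → sumBelow s (λ r → 1 + r C 2) ≡ s + s C 3
sumBelow-1+C2 zero = refl
sumBelow-1+C2 (suc s) = begin
  sumBelow (suc s) (λ r → 1 + r C 2)   ≡⟨ sumBelow-suc s (λ r → 1 + r C 2) ⟩
  sumBelow s (λ r → 1 + r C 2) + (1 + s C 2) ≡⟨ cong (_+ (1 + s C 2)) (sumBelow-1+C2 s) ⟩
  s + s C 3 + (1 + s C 2)              ≡⟨ rearrange s (s C 3) (s C 2) ⟩
  suc s + (s C 2 + s C 3)              ≡⟨ cong (suc s +_) (nCk+nC[k+1]≡[n+1]C[k+1] s 2) ⟩
  suc s + suc s C 3                    ∎
  where
  open ≡-Reasoning
  rearrange : ∀ a b c → a + b + (1 + c) ≡ suc a + (c + b)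
  rearrange = solve-∀

[r+1][r+2]≤6[1+rC2] : ∀ r → (r + 1) * (r + 2) ≤ 6 * (1 + r C 2)
[r+1][r+2]≤6[1+rC2] zero = s≤s (s≤s z≤n)
[r+1][r+2]≤6[1+rC2] (suc zero) = ≤-refl
[r+1][r+2]≤6[1+rC2] (suc (suc r)) = begin
  (suc (suc r) + 1) * (suc (suc r) + 2)
    ≡⟨ expand r ⟩
  (suc r + 1) * (suc r + 2) + (2 * r + 6)
    ≤⟨ +-mono-≤ ([r+1][r+2]≤6[1+rC2] (suc r)) (+-monoˡ-≤ 6 (*-monoˡ-≤ r (s≤s (s≤s (z≤n {4}))))) ⟩
  6 * (1 + suc r C 2) + (6 * r + 6)
    ≡⟨ collect r (suc r C 2) ⟩
  6 * (1 + (suc r + suc r C 2))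
    ≡⟨ cong (λ x → 6 * (1 + (x + suc r C 2))) (nC1≡n (suc r)) ⟨
  6 * (1 + (suc r C 1 + suc r C 2))
    ≡⟨ cong (λ x → 6 * (1 + x)) (nCk+nC[k+1]≡[n+1]C[k+1] (suc r) 1) ⟩
  6 * (1 + suc (suc r) C 2) ∎
  where
  open ≤-Reasoning
  expand : ∀ r → (suc (suc r) + 1) * (suc (suc r) + 2) ≡ (suc r + 1) * (suc r + 2) + (2 * r + 6)
  expand = solve-∀
  collect : ∀ r c → 6 * (1 + c) + (6 * r + 6) ≡ 6 * (1 + (suc r + c))
  collect = solve-∀

countᶠ-multiples-below : ∀ L c M → countᶠ L (λ t → (toℕ t + 1) * c <ᵇ M) * c ≤ M
countᶠ-multiples-below L c M with countᶠ L (λ t → (toℕ t + 1) * c <ᵇ M) in count≡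
... | zero = z≤n
... | suc N = subst (_≤ M) (cong (_* c) (+-comm N 1)) (<⇒≤ last-below)
  where
  closed : DownClosed (λ t → (toℕ t + 1) * c <ᵇ M)
  closed {i} {j} i≤j j-below =
    <⇒<ᵇ (≤-<-trans (*-monoˡ-≤ c (+-monoˡ-≤ 1 i≤j)) (<ᵇ⇒< _ M j-below))
  N<L : N < L
  N<L = <-≤-trans (n<1+n N) (subst (_≤ L) count≡ (countᶠ≤ L _))
  toℕ-N : toℕ (fromℕ< N<L) ≡ N
  toℕ-N = toℕ-fromℕ< N<L
  last-below : (N + 1) * c < M
  N<count : toℕ (fromℕ< N<L) < countᶠ L (λ t → (toℕ t + 1) * c <ᵇ M)
  N<count = subst₂ _<_ (sym toℕ-N) (sym count≡) (n<1+n N)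
  last-below = subst (λ x → (x + 1) * c < M) toℕ-N (<ᵇ⇒< _ M (countᶠ-downClosed closed N<count))

-- Σ_{r<R} 1/((r + 1)(r + 2)) = 1 − 1/(R + 1)
sumBelow-telescoping : ∀ (a : ℕ → ℕ) Q → (∀ r → (r + 1) * (r + 2) * a r ≤ Q) → ∀ R → sumBelow R a ≤ Q
sumBelow-telescoping a Q bounded R = *-cancelˡ-≤ (suc R) (begin
  suc R * sumBelow R a   ≤⟨ partial R ⟩
  R * Q                  ≤⟨ *-monoˡ-≤ Q (n≤1+n R) ⟩
  suc R * Q              ∎)
  where
  open ≤-Reasoning
  partial : ∀ R → suc R * sumBelow R a ≤ R * Q
  partial zero = z≤n
  partial (suc R) = *-cancelˡ-≤ (suc R) (begin
    suc R * (suc (suc R) * sumBelow (suc R) a)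
      ≡⟨ cong (λ x → suc R * (suc (suc R) * x)) (sumBelow-suc R a) ⟩
    suc R * (suc (suc R) * (sumBelow R a + a R))
      ≡⟨ split R (sumBelow R a) (a R) ⟩
    suc (suc R) * (suc R * sumBelow R a) + (R + 1) * (R + 2) * a R
      ≤⟨ +-mono-≤ (*-monoʳ-≤ (suc (suc R)) (partial R)) (bounded R) ⟩
    suc (suc R) * (R * Q) + Q
      ≡⟨ merge R Q ⟩
    suc R * (suc R * Q) ∎)
    where
    split : ∀ R s x → suc R * (suc (suc R) * (s + x)) ≡ suc (suc R) * (suc R * s) + (R + 1) * (R + 2) * x
    split = solve-∀
    merge : ∀ R Q → suc (suc R) * (R * Q) + Q ≡ suc R * (suc R * Q)
    merge = solve-∀

-- Cut level t into cells r < s t of weight (t + 1) * (1 + r C 2), which add up to the sum on the right;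
-- by telescoping at most S/2 cells weigh less than S/12, where S is the sum on the left.
levels-square-bound : ∀ L (s : ℕ → ℕ) →
  sumBelow L s * sumBelow L s ≤ 24 * sumBelow L (λ t → (t + 1) * (s t + s t C 3))
levels-square-bound L s = +-cancelʳ-≤ (S * S) (S * S) (24 * F) (begin
  S * S + S * S
    ≡⟨ cong (λ x → x + x) (*-distribʳ-sumᶠ L S _) ⟩
  sumBelow L (λ t → s t * S) + sumBelow L (λ t → s t * S)
    ≤⟨ +-mono-≤ rows rows ⟩
  12 * F + S * B + (12 * F + S * B)
    ≡⟨ regroup F S B ⟩
  24 * F + S * (2 * B)
    ≤⟨ +-monoʳ-≤ (24 * F) (*-monoʳ-≤ S light-cells) ⟩
  24 * F + S * S ∎)
  where
  open ≤-Reasoning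
  S = sumBelow L s
  F = sumBelow L (λ t → (t + 1) * (s t + s t C 3))
  G : ℕ → ℕ
  G r = 1 + r C 2
  light : ℕ → ℕ → Bool
  light t r = (t + 1) * (12 * G r) <ᵇ S
  lightBelow : ℕ → ℕ → ℕ
  lightBelow R t = sumBelow R (λ r → ⟦ light t r ⟧)
  B = sumBelow L (λ t → lightBelow (s t) t)

  cell : ∀ t r → S ≤ 12 * ((t + 1) * G r) + S * ⟦ light t r ⟧
  cell t r with light t r in light≡
  ... | true = ≤-trans (≤-reflexive (sym (*-identityʳ S))) (m≤n+m (S * 1) _)
  ... | false = ≤-trans (≮⇒≥ heavy) (≤-trans (≤-reflexive (swap (t + 1) (G r))) (m≤m+n _ (S * 0)))
    where
    heavy : ¬ (t + 1) * (12 * G r) < S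
    heavy lt = subst T light≡ (<⇒<ᵇ lt)
    swap : ∀ a g → a * (12 * g) ≡ 12 * (a * g)
    swap = solve-∀

  row : ∀ t → s t * S ≤ 12 * ((t + 1) * (s t + s t C 3)) + S * lightBelow (s t) t
  row t = begin
    s t * S
      ≡⟨ sumᶠ-const (s t) S ⟨
    sumBelow (s t) (λ _ → S)
      ≤⟨ sumᶠ-mono-≤ (s t) (λ r → cell t (toℕ r)) ⟩
    sumBelow (s t) (λ r → 12 * ((t + 1) * G r) + S * ⟦ light t r ⟧)
      ≡⟨ sumᶠ-distrib-+ (s t) _ _ ⟩
    sumBelow (s t) (λ r → 12 * ((t + 1) * G r)) + sumBelow (s t) (λ r → S * ⟦ light t r ⟧)
      ≡⟨ cong₂ _+_ (trans (sym (*-distribˡ-sumᶠ (s t) 12 _)) (cong (12 *_) (sym (*-distribˡ-sumᶠ (s t) (t + 1) _))))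
                   (sym (*-distribˡ-sumᶠ (s t) S _)) ⟩
    12 * ((t + 1) * sumBelow (s t) G) + S * lightBelow (s t) t
      ≡⟨ cong (λ x → 12 * ((t + 1) * x) + S * lightBelow (s t) t) (sumBelow-1+C2 (s t)) ⟩
    12 * ((t + 1) * (s t + s t C 3)) + S * lightBelow (s t) t ∎

  rows : sumBelow L (λ t → s t * S) ≤ 12 * F + S * B
  rows = begin
    sumBelow L (λ t → s t * S)
      ≤⟨ sumᶠ-mono-≤ L (λ t → row (toℕ t)) ⟩
    sumBelow L (λ t → 12 * ((t + 1) * (s t + s t C 3)) + S * lightBelow (s t) t)
      ≡⟨ sumᶠ-distrib-+ L _ _ ⟩
    sumBelow L (λ t → 12 * ((t + 1) * (s t + s t C 3))) + sumBelow L (λ t → S * lightBelow (s t) t)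
      ≡⟨ cong₂ _+_ (sym (*-distribˡ-sumᶠ L 12 _)) (sym (*-distribˡ-sumᶠ L S _)) ⟩
    12 * F + S * B ∎

  N : ℕ → ℕ
  N r = sumBelow L (λ t → ⟦ light t r ⟧)

  light-cells : 2 * B ≤ S
  light-cells = begin
    2 * B
      ≤⟨ *-monoʳ-≤ 2 (sumᶠ-mono-≤ L (λ t → sumBelow-mono-≤ (λ r → ⟦ light (toℕ t) r ⟧) (f≤sumᶠ L _ t))) ⟩
    2 * sumBelow L (λ t → lightBelow S t)
      ≡⟨ cong (2 *_) (sumᶠ-comm L S _) ⟩
    2 * sumBelow S N
      ≡⟨ *-distribˡ-sumᶠ S 2 _ ⟩
    sumBelow S (λ r → 2 * N r)
      ≤⟨ sumBelow-telescoping (λ r → 2 * N r) S few S ⟩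
    S ∎
    where
    few : ∀ r → (r + 1) * (r + 2) * (2 * N r) ≤ S
    few r = begin
      (r + 1) * (r + 2) * (2 * N r)   ≡⟨ shuffle ((r + 1) * (r + 2)) (N r) ⟩
      2 * ((r + 1) * (r + 2)) * N r   ≤⟨ *-monoˡ-≤ (N r) (*-monoʳ-≤ 2 ([r+1][r+2]≤6[1+rC2] r)) ⟩
      2 * (6 * G r) * N r             ≡⟨ shuffle′ (G r) (N r) ⟩
      N r * (12 * G r)                ≤⟨ countᶠ-multiples-below L (12 * G r) S ⟩
      S                               ∎
      where
      shuffle : ∀ p x → p * (2 * x) ≡ 2 * p * x
      shuffle = solve-∀
      shuffle′ : ∀ g x → 2 * (6 * g) * x ≡ x * (12 * g)
      shuffle′ = solve-∀

  regroup : ∀ F S B → 12 * F + S * B + (12 * F + S * B) ≡ 24 * F + S * (2 * B)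
  regroup = solve-∀

module _ {n : ℕ} (X : Fin n → Bool) (h : Fin n → ℕ) where

  level : ℕ → Fin n → Bool
  level t x = X x ∧ (h x ≡ᵇ t)

  linearWeight : ℕ
  linearWeight = sumᶠ n (λ x → ⟦ X x ⟧ * (h x + 1))

  tripleWeight : ℕ
  tripleWeight = sumᶠ n (λ u → sumᶠ n (λ v → sumᶠ n (λ w →
    ⟦ ⌊ u <ᶠ? v ⌋ ∧ ⌊ v <ᶠ? w ⌋ ∧ (X u ∧ level (h u) v ∧ level (h u) w) ⟧ * (h u + 1))))

  module _ (L : ℕ) (h<L : ∀ x → T (X x) → h x < L) where

    private
      s : ℕ → ℕ
      s t = countᶠ n (level t)

      outside : ∀ {x} → L ≤ h x → ⟦ X x ⟧ ≡ 0
      outside {x} L≤hx with X x in Xx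
      ... | false = refl
      ... | true = contradiction (h<L x (subst T (sym Xx) tt)) (≤⇒≯ L≤hx)

      level-sizes : countᶠ n X ≡ sumBelow L s
      level-sizes = trans (sumᶠ-by-fibres n L h _ (λ x → outside))
                          (sumᶠ-cong L λ t → sumᶠ-cong n λ x →
                             trans (*-comm _ ⟦ X x ⟧) (sym (⟦∧⟧ (X x) _)))

      linearWeight-by-level : linearWeight ≡ sumBelow L (λ t → (t + 1) * s t)
      linearWeight-by-level = trans (sumᶠ-by-fibres n L h _ (λ x L≤hx → cong (_* (h x + 1)) (outside L≤hx)))
                           (sumᶠ-cong L λ t → trans (sumᶠ-cong n (pointwise (toℕ t)))
                                                    (sym (*-distribˡ-sumᶠ n (toℕ t + 1) _)))
        where
        pointwise : ∀ t x → ⟦ h x ≡ᵇ t ⟧ * (⟦ X x ⟧ * (h x + 1)) ≡ (t + 1) * ⟦ level t x ⟧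
        pointwise t x = begin
          ⟦ h x ≡ᵇ t ⟧ * (⟦ X x ⟧ * (h x + 1))  ≡⟨ ⟦≡ᵇ⟧*-subst (h x) t (λ a → ⟦ X x ⟧ * (a + 1)) ⟩
          ⟦ h x ≡ᵇ t ⟧ * (⟦ X x ⟧ * (t + 1))    ≡⟨ rearrange ⟦ h x ≡ᵇ t ⟧ ⟦ X x ⟧ (t + 1) ⟩
          (t + 1) * (⟦ X x ⟧ * ⟦ h x ≡ᵇ t ⟧)    ≡⟨ cong ((t + 1) *_) (⟦∧⟧ (X x) _) ⟨
          (t + 1) * ⟦ level t x ⟧               ∎
          where
          open ≡-Reasoning
          rearrange : ∀ e a k → e * (a * k) ≡ k * (a * e)
          rearrange = solve-∀

      tripleWeight-by-level : tripleWeight ≡ sumBelow L (λ t → (t + 1) * (s t C 3))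
      tripleWeight-by-level = trans (sumᶠ-by-fibres n L h _ (λ u L≤hu → vanish u (outside L≤hu)))
                            (sumᶠ-cong L λ t → per-level (toℕ t))
        where
        weighted : ℕ → Fin n → Fin n → Fin n → ℕ
        weighted t u v w = ⟦ ⌊ u <ᶠ? v ⌋ ∧ ⌊ v <ᶠ? w ⌋ ∧ (X u ∧ level t v ∧ level t w) ⟧ * (t + 1)
        vanish : ∀ u → ⟦ X u ⟧ ≡ 0 → sumᶠ n (λ v → sumᶠ n (λ w → weighted (h u) u v w)) ≡ 0
        vanish u Xu≡0 = trans (sumᶠ-cong n λ v → trans (sumᶠ-cong n λ w → zero-term v w) (sumᶠ-zero n)) (sumᶠ-zero n)
          where
          zero-term : ∀ v w → weighted (h u) u v w ≡ 0
          zero-term v w rewrite ⟦∧∧-middle⟧ ⌊ u <ᶠ? v ⌋ ⌊ v <ᶠ? w ⌋ (X u) (level (h u) v ∧ level (h u) w) | Xu≡0 = refl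
        ordered : ℕ → Fin n → Fin n → Fin n → Bool
        ordered t u v w = ⌊ u <ᶠ? v ⌋ ∧ ⌊ v <ᶠ? w ⌋ ∧ (level t u ∧ level t v ∧ level t w)
        pointwise : ∀ t u v w → ⟦ h u ≡ᵇ t ⟧ * weighted t u v w ≡ (t + 1) * ⟦ ordered t u v w ⟧
        pointwise t u v w = begin
          ⟦ e ⟧ * (⟦ a ∧ b ∧ (X u ∧ l) ⟧ * (t + 1))
            ≡⟨ rearrange ⟦ e ⟧ ⟦ a ∧ b ∧ (X u ∧ l) ⟧ (t + 1) ⟩
          (t + 1) * (⟦ e ⟧ * ⟦ a ∧ b ∧ (X u ∧ l) ⟧)
            ≡⟨ cong ((t + 1) *_) (⟦∧∧-middle⟧ a b e (X u ∧ l)) ⟨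
          (t + 1) * ⟦ a ∧ b ∧ (e ∧ (X u ∧ l)) ⟧
            ≡⟨ cong (λ z → (t + 1) * ⟦ a ∧ b ∧ z ⟧) (∧-assoc e (X u) l) ⟨
          (t + 1) * ⟦ a ∧ b ∧ ((e ∧ X u) ∧ l) ⟧
            ≡⟨ cong (λ z → (t + 1) * ⟦ a ∧ b ∧ (z ∧ l) ⟧) (∧-comm e (X u)) ⟩
          (t + 1) * ⟦ a ∧ b ∧ (level t u ∧ l) ⟧ ∎
          where
          open ≡-Reasoning
          a = ⌊ u <ᶠ? v ⌋
          b = ⌊ v <ᶠ? w ⌋
          e = h u ≡ᵇ t
          l = level t v ∧ level t w
          rearrange : ∀ e x k → e * (x * k) ≡ k * (e * x)
          rearrange = solve-∀
        per-level : ∀ t → sumᶠ n (λ u → ⟦ h u ≡ᵇ t ⟧ * sumᶠ n (λ v → sumᶠ n (λ w → weighted (h u) u v w)))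
                          ≡ (t + 1) * (s t C 3)
        per-level t = begin
          sumᶠ n (λ u → ⟦ h u ≡ᵇ t ⟧ * sumᶠ n (λ v → sumᶠ n (λ w → weighted (h u) u v w)))
            ≡⟨ sumᶠ-cong n (λ u → ⟦≡ᵇ⟧*-subst (h u) t (λ t′ → sumᶠ n (λ v → sumᶠ n (λ w → weighted t′ u v w)))) ⟩
          sumᶠ n (λ u → ⟦ h u ≡ᵇ t ⟧ * sumᶠ n (λ v → sumᶠ n (λ w → weighted t u v w)))
            ≡⟨ sumᶠ-cong n (λ u → trans (*-distribˡ-sumᶠ n ⟦ h u ≡ᵇ t ⟧ _)
                                        (sumᶠ-cong n λ v → *-distribˡ-sumᶠ n ⟦ h u ≡ᵇ t ⟧ _)) ⟩
          sumᶠ n (λ u → sumᶠ n (λ v → sumᶠ n (λ w → ⟦ h u ≡ᵇ t ⟧ * weighted t u v w)))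
            ≡⟨ sumᶠ-cong n (λ u → sumᶠ-cong n λ v → sumᶠ-cong n λ w → pointwise t u v w) ⟩
          sumᶠ n (λ u → sumᶠ n (λ v → sumᶠ n (λ w → (t + 1) * ⟦ ordered t u v w ⟧)))
            ≡⟨ sumᶠ-cong n (λ u → trans (sumᶠ-cong n λ v → sym (*-distribˡ-sumᶠ n (t + 1) _))
                                        (sym (*-distribˡ-sumᶠ n (t + 1) _))) ⟩
          sumᶠ n (λ u → (t + 1) * sumᶠ n (λ v → countᶠ n (ordered t u v)))
            ≡⟨ *-distribˡ-sumᶠ n (t + 1) _ ⟨
          (t + 1) * triplesIn (level t)
            ≡⟨ cong ((t + 1) *_) (triplesIn-C3 (level t)) ⟩
          (t + 1) * (s t C 3) ∎
          where open ≡-Reasoning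

    graded-square-bound : countᶠ n X * countᶠ n X ≤ 24 * (linearWeight + tripleWeight)
    graded-square-bound = begin
      countᶠ n X * countᶠ n X
        ≡⟨ cong (λ x → x * x) level-sizes ⟩
      sumBelow L s * sumBelow L s
        ≤⟨ levels-square-bound L s ⟩
      24 * sumBelow L (λ t → (t + 1) * (s t + s t C 3))
        ≡⟨ cong (24 *_) (trans (sumᶠ-cong L λ t → *-distribˡ-+ (toℕ t + 1) _ _) (sumᶠ-distrib-+ L _ _)) ⟩
      24 * (sumBelow L (λ t → (t + 1) * s t) + sumBelow L (λ t → (t + 1) * (s t C 3)))
        ≡⟨ cong₂ (λ a b → 24 * (a + b)) linearWeight-by-level tripleWeight-by-level ⟨
      24 * (linearWeight + tripleWeight) ∎
      where open ≤-Reasoning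

-- Chains and heights

anyᶠ⁺ : ∀ m (p : Fin m → Bool) i → T (p i) → T (anyᶠ m p)
anyᶠ⁺ (suc m) p i pi with p zero in p₀
anyᶠ⁺ (suc m) p i pi | true = tt
anyᶠ⁺ (suc m) p zero pi | false = ⊥-elim (subst T p₀ pi)
anyᶠ⁺ (suc m) p (suc i) pi | false = anyᶠ⁺ m (p ∘ suc) i pi

anyᶠ⁻ : ∀ m (p : Fin m → Bool) → T (anyᶠ m p) → ∃ λ i → T (p i)
anyᶠ⁻ (suc m) p any with p zero in p₀
... | true = zero , subst T (sym p₀) tt
... | false = let i , pi = anyᶠ⁻ m (p ∘ suc) any in suc i , pi

AllPairs-lookup : ∀ {A : Set} {R : Rel A 0ℓ} {xs} → AllPairs R xs →
                  ∀ {i j} → i <ᶠ j → R (lookup xs i) (lookup xs j)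
AllPairs-lookup (Rx ∷ _) {zero} {suc j} _ = All.lookup Rx (∈-lookup j)
AllPairs-lookup (_ ∷ Rxs) {suc i} {suc j} (s≤s i<j) = AllPairs-lookup Rxs i<j

All-reverse⁺ : ∀ {A : Set} {P : U.Pred A 0ℓ} {xs} → All P xs → All P (reverse xs)
All-reverse⁺ [] = []
All-reverse⁺ {xs = x ∷ xs} (px ∷ pxs) = subst (All _) (sym (unfold-reverse x xs)) (All.∷ʳ⁺ (All-reverse⁺ pxs) px)

AllPairs-reverse⁺ : ∀ {A : Set} {R : Rel A 0ℓ} {xs} → AllPairs R xs → AllPairs (flip R) (reverse xs)
AllPairs-reverse⁺ [] = []
AllPairs-reverse⁺ {xs = x ∷ xs} (Rx ∷ Rxs) = subst (AllPairs _) (sym (unfold-reverse x xs))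
  (AllPairs.++⁺ (AllPairs-reverse⁺ Rxs) ([] ∷ []) (All.map (_∷ []) (All-reverse⁺ Rx)))

module _ {A : Set} {P : U.Pred A 0ℓ} (P? : U.Decidable P) where

  length-filter-tabulate : ∀ {m} (f : Fin m → A) → length (filter P? (tabulate f)) ≡ countᶠ m (λ i → ⌊ P? (f i) ⌋)
  length-filter-tabulate {zero} f = refl
  length-filter-tabulate {suc m} f with P? (f zero)
  ... | yes _ = cong suc (length-filter-tabulate (f ∘ suc))
  ... | no _ = length-filter-tabulate (f ∘ suc)

  All-filter-tabulate : ∀ {m} {Q : U.Pred A 0ℓ} (f : Fin m → A) → (∀ i → P (f i) → Q (f i)) →
                        All Q (filter P? (tabulate f))
  All-filter-tabulate {zero} f PQ = []
  All-filter-tabulate {suc m} f PQ with P? (f zero)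
  ... | yes p = PQ zero p ∷ All-filter-tabulate (f ∘ suc) (PQ ∘ suc)
  ... | no _ = All-filter-tabulate (f ∘ suc) (PQ ∘ suc)

module Height {n : ℕ} {R : Rel (Fin n) 0ℓ} (R? : Decidable R) (R-trans : Transitive R)
              (X : Fin n → Bool) (bound : ℕ) (bounded : ∀ {xs} → AllPairs R xs → length xs ≤ bound) where

  reach : ℕ → Fin n → Bool
  reach zero x = true
  reach (suc f) x = anyᶠ n (λ y → X y ∧ ⌊ R? x y ⌋ ∧ reach f y)

  ChainFrom : Fin n → ℕ → Set
  ChainFrom x f = ∃ λ ys → AllPairs R (x ∷ ys) × All (T ∘ X) ys × length ys ≡ f

  reach⇒chain : ∀ f x → T (reach f x) → ChainFrom x f
  reach⇒chain zero x _ = [] , [] ∷ [] , [] , refl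
  reach⇒chain (suc f) x reaches with anyᶠ⁻ n _ reaches
  ... | y , step with T-∧⁻ {X y} step
  ... | Xy , rest with T-∧⁻ {⌊ R? x y ⌋} rest
  ... | xRy , reaches′ with reach⇒chain f y reaches′
  ... | ys , (Ry ∷ Rys) , Xys , len =
    y ∷ ys , (toWitness xRy ∷ All.map (R-trans (toWitness xRy)) Ry) ∷ Ry ∷ Rys , Xy ∷ Xys , cong suc len

  reach-≤ : ∀ {i j} x → i ≤ j → T (reach j x) → T (reach i x)
  reach-≤ x z≤n _ = tt
  reach-≤ x (s≤s i≤j) reaches with anyᶠ⁻ n _ reaches
  ... | y , step with T-∧⁻ {X y} step
  ... | Xy , rest with T-∧⁻ {⌊ R? x y ⌋} rest
  ... | xRy , reaches′ = anyᶠ⁺ n _ y (T-∧⁺ Xy (T-∧⁺ xRy (reach-≤ y i≤j reaches′)))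

  reach<bound : ∀ {f} x → T (reach f x) → f < bound
  reach<bound {f} x reaches with reach⇒chain f x reaches
  ... | ys , chain , _ , len = subst (λ l → suc l ≤ bound) len (bounded chain)

  -- reach is down-closed in f (reach-≤), so this is the largest f with T (reach f x)
  height : Fin n → ℕ
  height x = countᶠ bound (λ f → reach (suc (toℕ f)) x)

  private
    closed : ∀ x → DownClosed (λ (f : Fin bound) → reach (suc (toℕ f)) x)
    closed x i≤j = reach-≤ x (s≤s i≤j)

  reach-height : ∀ x → T (reach (height x) x)
  reach-height x with height x in h≡
  ... | zero = tt
  ... | suc h = subst (λ f → T (reach (suc f) x)) (toℕ-fromℕ< h<bound)
                  (countᶠ-downClosed (closed x) (subst (_< height x) (sym (toℕ-fromℕ< h<bound))
                                                  (subst (h <_) (sym h≡) (n<1+n h))))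
    where
    h<bound : h < bound
    h<bound = <-≤-trans (n<1+n h) (subst (_≤ bound) h≡ (countᶠ≤ bound _))

  height-chain : ∀ x → ChainFrom x (height x)
  height-chain x = reach⇒chain (height x) x (reach-height x)

  height<bound : ∀ x → height x < bound
  height<bound x = reach<bound x (reach-height x)

  height-desc : ∀ {x y} → T (X y) → R x y → height y < height x
  height-desc {x} {y} Xy xRy = subst (_< height x) (toℕ-fromℕ< hy<bound) (<-countᶠ (closed x) x-reaches)
    where
    x-reaches′ : T (reach (suc (height y)) x)
    x-reaches′ = anyᶠ⁺ n _ y (T-∧⁺ Xy (T-∧⁺ (fromWitness xRy) (reach-height y)))
    hy<bound : height y < bound
    hy<bound = <-trans (n<1+n _) (reach<bound x x-reaches′)
    x-reaches : T (reach (suc (toℕ (fromℕ< hy<bound))) x)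
    x-reaches = subst (λ f → T (reach (suc f) x)) (sym (toℕ-fromℕ< hy<bound)) x-reaches′

-- Posets with a longest chain

module LongestChain {n : ℕ} {_≼_ : Rel (Fin n) 0ℓ} (po : IsDecPartialOrder _≡_ _≼_)
                    {k : ℕ} (c : Fin k → Fin n) (longest : IsLongestChain _≼_ k c) where

  open IsDecPartialOrder po using (antisym) renaming (refl to ≼-refl; trans to ≼-trans; _≤?_ to _≼?_)
  open Counts _≼?_ c

  _⊏_ : Rel (Fin n) 0ℓ
  _⊏_ = _≺_ _≼_

  ⊏-trans : Transitive _⊏_
  ⊏-trans (x≼y , x≢y) (y≼z , y≢z) = ≼-trans x≼y y≼z , λ { refl → x≢y (antisym x≼y y≼z) }

  _⊏?_ : Decidable _⊏_
  x ⊏? y = (x ≼? y) ×-dec ¬? (x ≟ᶠ y)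

  c-mono : ∀ {i j} → toℕ i ≤ toℕ j → c i ≼ c j
  c-mono {i} {j} i≤j with m≤n⇒m<n∨m≡n i≤j
  ... | inj₁ i<j = proj₁ (proj₁ longest i j i<j)
  ... | inj₂ i≡j rewrite toℕ-injective i≡j = ≼-refl

  chain-length : ∀ {xs} → AllPairs _⊏_ xs → length xs ≤ k
  chain-length {xs} chain = proj₂ longest (length xs) (lookup xs) (λ i j → AllPairs-lookup chain)

  OutC : Fin n → Set
  OutC x = ∀ j → c j ≢ x

  outC⇒OutC : ∀ {x} → T (outC x) → OutC x
  outC⇒OutC {x} out j refl = T-not⁻ out (anyᶠ⁺ k (λ i → ⌊ c i ≟ᶠ c j ⌋) j (fromWitness refl))

  -- c j ≼ x exactly for j < lower x, and x ⋠ c j exactly for j < upper x;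
  -- so c j ∥ x iff lower x ≤ j < upper x, and x ∈ P i iff lower x ≤ i ≤ upper x.
  lower upper : Fin n → ℕ
  lower x = countᶠ k (λ j → le (c j) x)
  upper x = countᶠ k (λ j → not (le x (c j)))

  private
    below-closed : ∀ x → DownClosed (λ j → le (c j) x)
    below-closed x i≤j cj≼x = fromWitness (≼-trans (c-mono i≤j) (toWitness cj≼x))

    notAbove-closed : ∀ x → DownClosed (λ j → not (le x (c j)))
    notAbove-closed x i≤j x⋠cj = fromWitnessFalse (λ x≼ci → toWitnessFalse x⋠cj (≼-trans x≼ci (c-mono i≤j)))

  ≼⇒<lower : ∀ {j x} → c j ≼ x → toℕ j < lower x
  ≼⇒<lower {x = x} cj≼x = <-countᶠ (below-closed x) (fromWitness cj≼x)

  <lower⇒≼ : ∀ {j x} → toℕ j < lower x → c j ≼ x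
  <lower⇒≼ {x = x} j<lower = toWitness (countᶠ-downClosed (below-closed x) j<lower)

  ⋠⇒<upper : ∀ {j x} → ¬ x ≼ c j → toℕ j < upper x
  ⋠⇒<upper {x = x} x⋠cj = <-countᶠ (notAbove-closed x) (fromWitnessFalse x⋠cj)

  upper≤⇒≼ : ∀ {j x} → upper x ≤ toℕ j → x ≼ c j
  upper≤⇒≼ {j} {x} upper≤j with x ≼? c j
  ... | yes x≼cj = x≼cj
  ... | no x⋠cj = contradiction (⋠⇒<upper x⋠cj) (≤⇒≯ upper≤j)

  <upper⇒⋠ : ∀ {j x} → toℕ j < upper x → T (not (le x (c j)))
  <upper⇒⋠ {x = x} = countᶠ-downClosed (notAbove-closed x)

  inP⁺ : ∀ {i x} → lower x ≤ toℕ i → toℕ i ≤ upper x → T (inP i x)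
  inP⁺ {i} {x} lower≤i i≤upper = T-∧⁺ (low i i≤upper) high
    where
    low : ∀ i → toℕ i ≤ upper x → T (lowOK i x)
    low zero _ = tt
    low (suc j) j<upper = <upper⇒⋠ j<upper
    high : T (highOK i x)
    high with toℕ i <? k
    ... | yes i<k = T-not⁺ λ cᵢ≼x → <⇒≱ (subst (_< lower x) (toℕ-fromℕ< i<k) (≼⇒<lower (toWitness cᵢ≼x))) lower≤i
    ... | no _ = tt

  inc-c⁺ : ∀ {j x} → lower x ≤ toℕ j → toℕ j < upper x → T (inc (c j) x)
  inc-c⁺ lower≤j j<upper = T-∧⁺ (T-not⁺ λ cj≼x → <⇒≱ (≼⇒<lower (toWitness cj≼x)) lower≤j) (<upper⇒⋠ j<upper)

  Between : Fin n → Fin n → Set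
  Between x y = (∀ j → c j ≼ x → c j ≼ y) × (∀ j → x ≼ c j → y ≼ c j)

  -- The elements of C below x, then ys, then the elements of C above x form a chain of P.
  chain-replacement : ∀ {x ys} → OutC x → AllPairs _⊏_ ys → All (λ y → OutC y × Between x y) ys →
                      lower x + length ys ≤ upper x
  chain-replacement {x} {ys} outx ys-chain ys-between =
    +-cancelʳ-≤ (above x) (lower x + length ys) (upper x) (begin
      lower x + length ys + above x
        ≡⟨ +-assoc (lower x) (length ys) (above x) ⟩
      lower x + (length ys + above x)
        ≡⟨ cong₂ (λ a b → a + (length ys + b)) (length-filter-tabulate (_≼? x) c) (length-filter-tabulate (x ≼?_) c) ⟨
      length below + (length ys + length over)
        ≡⟨ cong (length below +_) (length-++ ys) ⟨
      length below + length (ys ++ over)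
        ≡⟨ length-++ below ⟨
      length (below ++ ys ++ over)
        ≤⟨ chain-length full-chain ⟩
      k
        ≡⟨ trans (+-comm (upper x) (above x)) (countᶠ-complement k (λ j → le x (c j))) ⟨
      upper x + above x ∎)
    where
    open ≤-Reasoning
    above : Fin n → ℕ
    above y = countᶠ k (λ j → le y (c j))
    cs = tabulate c
    below = filter (_≼? x) cs
    over = filter (x ≼?_) cs
    cs-chain : AllPairs _⊏_ cs
    cs-chain = AllPairs.tabulate⁺-< (λ {i} {j} i<j → proj₁ longest i j i<j)
    ys⊏over : All (λ y → All (y ⊏_) over) ys
    ys⊏over = All.map (λ { (outy , _ , up) →
                All-filter-tabulate (x ≼?_) c λ j x≼cj → up j x≼cj , λ y≡cj → outy j (sym y≡cj) })
              ys-between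
    below⊏rest : All (λ z → All (z ⊏_) (ys ++ over)) below
    below⊏rest = All-filter-tabulate (_≼? x) c λ j cj≼x →
      All.++⁺ (All.map (λ { (outy , down , _) → down j cj≼x , outy j }) ys-between)
              (All-filter-tabulate (x ≼?_) c λ j′ x≼cj′ →
                 ≼-trans cj≼x x≼cj′ , λ cj≡cj′ → outx j (antisym cj≼x (subst (x ≼_) (sym cj≡cj′) x≼cj′)))
    full-chain : AllPairs _⊏_ (below ++ ys ++ over)
    full-chain = AllPairs.++⁺ (AllPairs.filter⁺ _ cs-chain)
                              (AllPairs.++⁺ ys-chain (AllPairs.filter⁺ _ cs-chain) ys⊏over)
                              below⊏rest

  lower<upper : ∀ {x} → OutC x → lower x < upper x
  lower<upper {x} outx = subst (_≤ upper x) (+-comm (lower x) 1)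
    (chain-replacement outx ([] ∷ []) ((outx , (λ _ cj≼x → cj≼x) , (λ _ x≼cj → x≼cj)) ∷ []))

  -- The intervals [lower, upper) of u and v are disjoint and, as u ⋠ v, adjacent.
  lower≡upper : ∀ {u v} → OutC u → ¬ u ≼ v → (∀ j → T (inc (c j) u) → ¬ T (inc (c j) v)) →
                upper u ≤ upper v → lower v ≡ upper u
  lower≡upper {u} {v} outu u⋠v disjoint upper-u≤upper-v = ≤-antisym lower-v≤upper-u upper-u≤lower-v
    where
    upper-u≤lower-v : upper u ≤ lower v
    upper-u≤lower-v = ≮⇒≥ λ lower-v<upper-u →
      let j₀<upper-u = ⊔-pres-<m (lower<upper outu) lower-v<upper-u
          j = fromℕ< (<-≤-trans j₀<upper-u (countᶠ≤ k _))
          toℕj≡ = toℕ-fromℕ< (<-≤-trans j₀<upper-u (countᶠ≤ k _))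
      in disjoint j
           (inc-c⁺ (subst (lower u ≤_) (sym toℕj≡) (m≤m⊔n _ _)) (subst (_< upper u) (sym toℕj≡) j₀<upper-u))
           (inc-c⁺ (subst (lower v ≤_) (sym toℕj≡) (m≤n⊔m _ _))
                   (subst (_< upper v) (sym toℕj≡) (<-≤-trans j₀<upper-u upper-u≤upper-v)))
    lower-v≤upper-u : lower v ≤ upper u
    lower-v≤upper-u = ≮⇒≥ λ upper-u<lower-v →
      let j = fromℕ< (<-≤-trans upper-u<lower-v (countᶠ≤ k _))
          toℕj≡ = toℕ-fromℕ< (<-≤-trans upper-u<lower-v (countᶠ≤ k _))
      in u⋠v (≼-trans (upper≤⇒≼ (≤-reflexive (sym toℕj≡))) (<lower⇒≼ (subst (_< lower v) (sym toℕj≡) upper-u<lower-v)))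

  _⊲_ : Fin n → Fin n → Bool
  u ⊲ v = outC u ∧ outC v ∧ (lower v ≡ᵇ upper u)

  Q'''⇒⊲ : ∀ u v → ⟦ isQ''' u v ⟧ ≤ ⟦ u ⊲ v ⟧ + ⟦ v ⊲ u ⟧
  Q'''⇒⊲ u v with isQ''' u v in Q≡
  ... | false = z≤n
  ... | true with T-∧⁻ {outC u} (subst T (sym Q≡) tt)
  ... | outu , rest with T-∧⁻ {outC v} rest
  ... | outv , rest′ with T-∧⁻ {inc u v} rest′
  ... | u∥v , no-common with T-∧⁻ {not (le u v)} u∥v | ≤-total (upper u) (upper v)
  ... | u⋠v , v⋠u | inj₁ upper-u≤upper-v =
    ≤-trans (≤-reflexive (sym (T⇒⟦⟧≡1 (T-∧⁺ outu (T-∧⁺ outv (≡⇒≡ᵇ _ _ lower-v≡upper-u))))))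
            (m≤m+n ⟦ u ⊲ v ⟧ ⟦ v ⊲ u ⟧)
    where
    disjoint : ∀ j → T (inc (c j) u) → ¬ T (inc (c j) v)
    disjoint j cj∥u cj∥v = T-not⁻ no-common (anyᶠ⁺ k _ j (T-∧⁺ cj∥u cj∥v))
    lower-v≡upper-u = lower≡upper (outC⇒OutC outu) (toWitnessFalse u⋠v) disjoint upper-u≤upper-v
  ... | u⋠v , v⋠u | inj₂ upper-v≤upper-u =
    ≤-trans (≤-reflexive (sym (T⇒⟦⟧≡1 (T-∧⁺ outv (T-∧⁺ outu (≡⇒≡ᵇ _ _ lower-u≡upper-v))))))
            (m≤n+m ⟦ v ⊲ u ⟧ ⟦ u ⊲ v ⟧)
    where
    disjoint : ∀ j → T (inc (c j) v) → ¬ T (inc (c j) u)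
    disjoint j cj∥v cj∥u = T-not⁻ no-common (anyᶠ⁺ k _ j (T-∧⁺ cj∥u cj∥v))
    lower-u≡upper-v = lower≡upper (outC⇒OutC outv) (toWitnessFalse v⋠u) disjoint upper-v≤upper-u

  nWithin t''Within : (Fin n → Bool) → ℕ
  nWithin X = sumᶠ (suc k) (λ i → countᶠ n (λ x → inP i x ∧ X x))
  t''Within X = sumᶠ (suc k) (λ i → countTriples (λ u v w →
                  (isT'' u v w ∧ inP i u ∧ inP i v ∧ inP i w) ∧ (X u ∧ X v ∧ X w)))

  module Graded (X : Fin n → Bool) (h : Fin n → ℕ) (lo : ℕ → ℕ) (cut : ℕ)
    (X⇒outC : ∀ {x} → T (X x) → T (outC x))
    (X⇒cut : ∀ {x} → T (X x) → lower x ≤ cut × cut < upper x)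
    (X⇒window : ∀ {x} → T (X x) → lower x ≤ lo (h x) × lo (h x) + h x ≤ upper x)
    (levels-antichains : ∀ {x y} → T (X x) → T (X y) → x ≢ y → h x ≡ h y → T (inc x y))
    (h<k : ∀ {x} → T (X x) → h x < k)
    where

    private
      window⇒inP : ∀ {x i} → T (X x) → lo (h x) ≤ toℕ i → toℕ i ≤ lo (h x) + h x → T (inP i x)
      window⇒inP Xx lo≤i i≤hi = inP⁺ (≤-trans (proj₁ (X⇒window Xx)) lo≤i) (≤-trans i≤hi (proj₂ (X⇒window Xx)))

      window<suc-k : ∀ {x} → T (X x) → lo (h x) + h x < suc k
      window<suc-k Xx = s≤s (≤-trans (proj₂ (X⇒window Xx)) (countᶠ≤ k _))

      cut-index : ∀ {x} → T (X x) → Fin k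
      cut-index Xx = fromℕ< (<-≤-trans (proj₂ (X⇒cut Xx)) (countᶠ≤ k _))

      X⇒inc-cut : ∀ {x y} (Xx : T (X x)) → T (X y) → T (inc (c (cut-index Xx)) y)
      X⇒inc-cut {y = y} Xx Xy =
        inc-c⁺ (subst (lower y ≤_) (sym cut≡) (proj₁ (X⇒cut Xy))) (subst (_< upper y) (sym cut≡) (proj₂ (X⇒cut Xy)))
        where
        cut≡ : toℕ (cut-index Xx) ≡ cut
        cut≡ = toℕ-fromℕ< (<-≤-trans (proj₂ (X⇒cut Xx)) (countᶠ≤ k _))

    linear≤ : linearWeight X h ≤ nWithin X
    linear≤ = begin
      linearWeight X h
        ≤⟨ sumᶠ-mono-≤ n pointwise ⟩
      sumᶠ n (λ x → sumᶠ (suc k) (λ i → ⟦ inP i x ∧ X x ⟧))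
        ≡⟨ sumᶠ-comm n (suc k) (λ x i → ⟦ inP i x ∧ X x ⟧) ⟩
      nWithin X ∎
      where
      open ≤-Reasoning
      pointwise : ∀ x → ⟦ X x ⟧ * (h x + 1) ≤ countᶠ (suc k) (λ i → inP i x ∧ X x)
      pointwise x with X x in X≡
      ... | false = z≤n
      ... | true = ≤-trans (≤-reflexive (trans (*-identityˡ (h x + 1)) (+-comm (h x) 1)))
                     (countᶠ-interval (suc k) (lo (h x)) (h x) _ (window<suc-k Xx)
                        λ i lo≤i i≤hi → T-∧⁺ (window⇒inP Xx lo≤i i≤hi) tt)
        where
        Xx : T (X x)
        Xx = subst T (sym X≡) tt

    triple≤ : tripleWeight X h ≤ t''Within X
    triple≤ = begin
      tripleWeight X h
        ≤⟨ sumᶠ-mono-≤ n (λ u → sumᶠ-mono-≤ n λ v → sumᶠ-mono-≤ n λ w → pointwise u v w) ⟩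
      sumᶠ n (λ u → sumᶠ n (λ v → sumᶠ n (λ w → sumᶠ (suc k) (λ i → ⟦ F i u v w ⟧))))
        ≡⟨ sumᶠ-cong n (λ u → sumᶠ-cong n λ v → sumᶠ-comm (suc k) n (λ i w → ⟦ F i u v w ⟧)) ⟨
      sumᶠ n (λ u → sumᶠ n (λ v → sumᶠ (suc k) (λ i → countᶠ n (F i u v))))
        ≡⟨ sumᶠ-cong n (λ u → sumᶠ-comm (suc k) n (λ i v → countᶠ n (F i u v))) ⟨
      sumᶠ n (λ u → sumᶠ (suc k) (λ i → sumᶠ n (λ v → countᶠ n (F i u v))))
        ≡⟨ sumᶠ-comm (suc k) n (λ i u → sumᶠ n (λ v → countᶠ n (F i u v))) ⟨
      t''Within X ∎
      where
      open ≤-Reasoning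
      F : Fin (suc k) → Fin n → Fin n → Fin n → Bool
      F i u v w = lt u v ∧ lt v w ∧ ((isT'' u v w ∧ inP i u ∧ inP i v ∧ inP i w) ∧ (X u ∧ X v ∧ X w))
      pointwise : ∀ u v w →
        ⟦ lt u v ∧ lt v w ∧ (X u ∧ level X h (h u) v ∧ level X h (h u) w) ⟧ * (h u + 1) ≤ countᶠ (suc k) (λ i → F i u v w)
      pointwise u v w with lt u v ∧ lt v w ∧ (X u ∧ level X h (h u) v ∧ level X h (h u) w) in W≡
      ... | false = z≤n
      ... | true with T-∧⁻ {lt u v} (subst T (sym W≡) tt)
      ... | u<v , W₁ with T-∧⁻ {lt v w} W₁
      ... | v<w , W₂ with T-∧⁻ {X u} W₂
      ... | Xu , W₃ with T-∧⁻ {level X h (h u) v} W₃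
      ... | v-level , w-level with T-∧⁻ {X v} v-level | T-∧⁻ {X w} w-level
      ... | Xv , hv≡ᵇhu | Xw , hw≡ᵇhu =
        ≤-trans (≤-reflexive (trans (*-identityˡ (h u + 1)) (+-comm (h u) 1)))
                (countᶠ-interval (suc k) (lo (h u)) (h u) _ (window<suc-k Xu) in-F)
        where
        hv≡hu = ≡ᵇ⇒≡ (h v) (h u) hv≡ᵇhu
        hw≡hu = ≡ᵇ⇒≡ (h w) (h u) hw≡ᵇhu
        u≢v = <ᶠ⇒≢ (toWitness u<v)
        v≢w = <ᶠ⇒≢ (toWitness v<w)
        u≢w = <ᶠ⇒≢ (<ᶠ-trans (toWitness u<v) (toWitness v<w))
        isT : T (isT'' u v w)
        isT = T-∧⁺ (X⇒outC Xu) (T-∧⁺ (X⇒outC Xv) (T-∧⁺ (X⇒outC Xw)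
                (T-∧⁺ (levels-antichains Xu Xv u≢v (sym hv≡hu)) (T-∧⁺ (levels-antichains Xu Xw u≢w (sym hw≡hu))
                (T-∧⁺ (levels-antichains Xv Xw v≢w (trans hv≡hu (sym hw≡hu)))
                (anyᶠ⁺ k _ (cut-index Xu) (T-∧⁺ (X⇒inc-cut Xu Xu) (T-∧⁺ (X⇒inc-cut Xu Xv) (X⇒inc-cut Xu Xw)))))))))
        same-window : ∀ {y i} → T (X y) → h y ≡ h u → lo (h u) ≤ toℕ i → toℕ i ≤ lo (h u) + h u → T (inP i y)
        same-window Xy hy≡hu lo≤i i≤hi =
          window⇒inP Xy (subst (λ t → lo t ≤ _) (sym hy≡hu) lo≤i) (subst (λ t → _ ≤ lo t + t) (sym hy≡hu) i≤hi)
        in-F : ∀ i → lo (h u) ≤ toℕ i → toℕ i ≤ lo (h u) + h u → T (F i u v w)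
        in-F i lo≤i i≤hi = T-∧⁺ u<v (T-∧⁺ v<w (T-∧⁺
          (T-∧⁺ isT (T-∧⁺ (window⇒inP Xu lo≤i i≤hi)
                    (T-∧⁺ (same-window Xv hv≡hu lo≤i i≤hi) (same-window Xw hw≡hu lo≤i i≤hi))))
          (T-∧⁺ Xu (T-∧⁺ Xv Xw))))

    square-bound : countᶠ n X * countᶠ n X ≤ 24 * (nWithin X + t''Within X)
    square-bound = ≤-trans (graded-square-bound X h k (λ _ → h<k)) (*-monoʳ-≤ 24 (+-mono-≤ linear≤ triple≤))

  fibre : (Fin n → ℕ) → ℕ → Fin n → Bool
  fibre key p x = outC x ∧ (key x ≡ᵇ p)

  private
    fibre⇒OutC : ∀ {key p x} → T (fibre key p x) → OutC x
    fibre⇒OutC Xx = outC⇒OutC (proj₁ (T-∧⁻ Xx))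

    fibre⇒≡ : ∀ {key p x} → T (fibre key p x) → key x ≡ p
    fibre⇒≡ {key} {p} {x} Xx = ≡ᵇ⇒≡ (key x) p (proj₂ (T-∧⁻ {outC x} Xx))

    antichain : ∀ {X : Fin n → Bool} {h : Fin n → ℕ} → (∀ {x y} → T (X x) → T (X y) → x ⊏ y → h x ≢ h y) →
                ∀ {x y} → T (X x) → T (X y) → x ≢ y → h x ≡ h y → T (inc x y)
    antichain separated {x} {y} Xx Xy x≢y hx≡hy =
      T-∧⁺ (fromWitnessFalse {a? = x ≼? y} λ x≼y → separated Xx Xy (x≼y , x≢y) hx≡hy)
           (fromWitnessFalse {a? = y ≼? x} λ y≼x → separated Xy Xx (y≼x , x≢y ∘ sym) (sym hx≡hy))

    pred<self : ∀ {m p} → m < p → pred p < p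
    pred<self (s≤s _) = ≤-refl

  -- Heights are taken upwards in fibre upper p: an element with a chain of h elements above it
  -- inside the fibre lies in P i for p − h ≤ i ≤ p.
  upper-fibre-bound : ∀ p → countᶠ n (fibre upper p) * countᶠ n (fibre upper p)
                            ≤ 24 * (nWithin (fibre upper p) + t''Within (fibre upper p))
  upper-fibre-bound p = Graded.square-bound X height (p ∸_) (pred p)
    (proj₁ ∘ T-∧⁻) X⇒cut X⇒window (antichain separated) (λ {x} _ → height<bound x)
    where
    X = fibre upper p
    open Height _⊏?_ ⊏-trans X k chain-length
    X⇒OutC : ∀ {x} → T (X x) → OutC x
    X⇒OutC = fibre⇒OutC {upper} {p}
    upper≡p : ∀ {x} → T (X x) → upper x ≡ p
    upper≡p = fibre⇒≡ {upper} {p}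
    span : ∀ {x} → T (X x) → lower x + suc (height x) ≤ p
    span {x} Xx with height-chain x
    ... | ys , chain@(x⊏ys ∷ _) , Xys , len =
      subst₂ _≤_ (cong (λ l → lower x + suc l) len) (upper≡p Xx)
        (chain-replacement outx chain ((outx , (λ _ q → q) , (λ _ q → q)) ∷ All.zipWith between (x⊏ys , Xys)))
      where
      outx = X⇒OutC Xx
      between : ∀ {y} → x ⊏ y × T (X y) → OutC y × Between x y
      between ((x≼y , _) , Xy) = X⇒OutC Xy , (λ _ cj≼x → ≼-trans cj≼x x≼y) ,
        λ j x≼cj → upper≤⇒≼ (subst (_≤ toℕ j) (trans (upper≡p Xx) (sym (upper≡p Xy)))
                                  (≮⇒≥ λ j<upper → toWitnessFalse (<upper⇒⋠ j<upper) x≼cj))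
    X⇒cut : ∀ {x} → T (X x) → lower x ≤ pred p × pred p < upper x
    X⇒cut Xx = <⇒≤pred lower<p , subst (pred p <_) (sym (upper≡p Xx)) (pred<self lower<p)
      where lower<p = <-≤-trans (m<m+n _ (s≤s z≤n)) (span Xx)
    X⇒window : ∀ {x} → T (X x) → lower x ≤ p ∸ height x × p ∸ height x + height x ≤ upper x
    X⇒window {x} Xx = m+n≤o⇒m≤o∸n (lower x) (≤-trans (+-monoʳ-≤ (lower x) (n≤1+n _)) (span Xx))
                    , ≤-reflexive (trans (m∸n+n≡m h≤p) (sym (upper≡p Xx)))
      where h≤p = ≤-trans (n≤1+n _) (≤-trans (m≤n+m _ (lower x)) (span Xx))
    separated : ∀ {x y} → T (X x) → T (X y) → x ⊏ y → height x ≢ height y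
    separated Xx Xy x⊏y hx≡hy = <-irrefl (sym hx≡hy) (height-desc Xy x⊏y)

  -- Heights are taken downwards in fibre lower p: an element with a chain of h elements below it
  -- inside the fibre lies in P i for p ≤ i ≤ p + h.
  lower-fibre-bound : ∀ p → countᶠ n (fibre lower p) * countᶠ n (fibre lower p)
                            ≤ 24 * (nWithin (fibre lower p) + t''Within (fibre lower p))
  lower-fibre-bound p = Graded.square-bound X height (λ _ → p) p
    (proj₁ ∘ T-∧⁻) X⇒cut X⇒window (antichain separated) (λ {x} _ → height<bound x)
    where
    X = fibre lower p
    open Height (flip _⊏?_) (flip ⊏-trans) X k
                (λ {xs} chain → subst (_≤ k) (length-reverse xs) (chain-length (AllPairs-reverse⁺ chain)))
    X⇒OutC : ∀ {x} → T (X x) → OutC x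
    X⇒OutC = fibre⇒OutC {lower} {p}
    lower≡p : ∀ {x} → T (X x) → lower x ≡ p
    lower≡p = fibre⇒≡ {lower} {p}
    span : ∀ {x} → T (X x) → p + suc (height x) ≤ upper x
    span {x} Xx with height-chain x
    ... | ys , chain@(ys⊏x ∷ _) , Xys , len =
      subst (_≤ upper x) (cong₂ _+_ (lower≡p Xx) (trans (length-reverse (x ∷ ys)) (cong suc len)))
        (chain-replacement outx (AllPairs-reverse⁺ chain)
           (All-reverse⁺ ((outx , (λ _ q → q) , (λ _ q → q)) ∷ All.zipWith between (ys⊏x , Xys))))
      where
      outx = X⇒OutC Xx
      between : ∀ {y} → y ⊏ x × T (X y) → OutC y × Between x y
      between ((y≼x , _) , Xy) = X⇒OutC Xy ,
        (λ j cj≼x → <lower⇒≼ (subst (toℕ j <_) (trans (lower≡p Xx) (sym (lower≡p Xy))) (≼⇒<lower cj≼x))) ,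
        (λ _ x≼cj → ≼-trans y≼x x≼cj)
    X⇒cut : ∀ {x} → T (X x) → lower x ≤ p × p < upper x
    X⇒cut Xx = ≤-reflexive (lower≡p Xx) , subst (_< upper _) (lower≡p Xx) (lower<upper (X⇒OutC Xx))
    X⇒window : ∀ {x} → T (X x) → lower x ≤ p × p + height x ≤ upper x
    X⇒window Xx = ≤-reflexive (lower≡p Xx) , ≤-trans (+-monoʳ-≤ p (n≤1+n _)) (span Xx)
    separated : ∀ {x y} → T (X x) → T (X y) → x ⊏ y → height x ≢ height y
    separated Xx Xy x⊏y hx≡hy = <-irrefl hx≡hy (height-desc Xx x⊏y)

  module _ (key : Fin n → ℕ) (key≤k : ∀ x → key x ≤ k) where

    private
      unique : ∀ {a} x p → T (a ∧ fibre key p x) → T a × key x ≡ p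
      unique {a} x p a∧x∈ = proj₁ (T-∧⁻ {a} a∧x∈) , fibre⇒≡ {key} {p} (proj₂ (T-∧⁻ {a} a∧x∈))

    fibres-nWithin : sumBelow (suc k) (λ p → nWithin (fibre key p)) ≤ sumᶠ (suc k) nᵢ
    fibres-nWithin = begin
      sumBelow (suc k) (λ p → sumᶠ (suc k) (λ i → sumᶠ n (λ x → ⟦ inP i x ∧ fibre key p x ⟧)))
        ≡⟨ sumᶠ-comm (suc k) (suc k) (λ p i → sumᶠ n (λ x → ⟦ inP i x ∧ fibre key (toℕ p) x ⟧)) ⟩
      sumᶠ (suc k) (λ i → sumBelow (suc k) (λ p → sumᶠ n (λ x → ⟦ inP i x ∧ fibre key p x ⟧)))
        ≡⟨ sumᶠ-cong (suc k) (λ i → sumᶠ-comm (suc k) n (λ p x → ⟦ inP i x ∧ fibre key (toℕ p) x ⟧)) ⟩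
      sumᶠ (suc k) (λ i → sumᶠ n (λ x → sumBelow (suc k) (λ p → ⟦ inP i x ∧ fibre key p x ⟧)))
        ≤⟨ sumᶠ-mono-≤ (suc k) (λ i → sumᶠ-mono-≤ n λ x →
             sumBelow-unique (suc k) (key x) _ (inP i x) (s≤s (key≤k x)) (unique x)) ⟩
      sumᶠ (suc k) nᵢ ∎
      where open ≤-Reasoning

    fibres-t''Within : sumBelow (suc k) (λ p → t''Within (fibre key p)) ≤ sumᶠ (suc k) t''ᵢ
    fibres-t''Within = begin
      sumBelow (suc k) (λ p → sumᶠ (suc k) (λ i → Σ³ (λ u v w → ⟦ G p i u v w ⟧)))
        ≡⟨ sumᶠ-comm (suc k) (suc k) (λ p i → Σ³ (λ u v w → ⟦ G (toℕ p) i u v w ⟧)) ⟩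
      sumᶠ (suc k) (λ i → sumBelow (suc k) (λ p → Σ³ (λ u v w → ⟦ G p i u v w ⟧)))
        ≡⟨ sumᶠ-cong (suc k) (λ i →
             trans (sumᶠ-comm (suc k) n (λ p u → sumᶠ n (λ v → sumᶠ n (λ w → ⟦ G (toℕ p) i u v w ⟧))))
             (sumᶠ-cong n λ u → trans (sumᶠ-comm (suc k) n (λ p v → sumᶠ n (λ w → ⟦ G (toℕ p) i u v w ⟧)))
             (sumᶠ-cong n λ v → sumᶠ-comm (suc k) n (λ p w → ⟦ G (toℕ p) i u v w ⟧)))) ⟩
      sumᶠ (suc k) (λ i → Σ³ (λ u v w → sumBelow (suc k) (λ p → ⟦ G p i u v w ⟧)))
        ≤⟨ sumᶠ-mono-≤ (suc k) (λ i → sumᶠ-mono-≤ n λ u → sumᶠ-mono-≤ n λ v → sumᶠ-mono-≤ n λ w →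
             sumBelow-unique (suc k) (key u) _ _ (s≤s (key≤k u)) (decode i u v w)) ⟩
      sumᶠ (suc k) t''ᵢ ∎
      where
      open ≤-Reasoning
      Σ³ : (Fin n → Fin n → Fin n → ℕ) → ℕ
      Σ³ f = sumᶠ n (λ u → sumᶠ n (λ v → sumᶠ n (λ w → f u v w)))
      T''ᵢ : Fin (suc k) → Fin n → Fin n → Fin n → Bool
      T''ᵢ i u v w = isT'' u v w ∧ inP i u ∧ inP i v ∧ inP i w
      G : ℕ → Fin (suc k) → Fin n → Fin n → Fin n → Bool
      G p i u v w = lt u v ∧ lt v w ∧ (T''ᵢ i u v w ∧ (fibre key p u ∧ fibre key p v ∧ fibre key p w))
      decode : ∀ i u v w p → T (G p i u v w) → T (lt u v ∧ lt v w ∧ T''ᵢ i u v w) × key u ≡ p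
      decode i u v w p Gp with T-∧⁻ {lt u v} Gp
      ... | u<v , G₁ with T-∧⁻ {lt v w} G₁
      ... | v<w , G₂ with T-∧⁻ {T''ᵢ i u v w} G₂
      ... | t , G₃ = T-∧⁺ u<v (T-∧⁺ v<w t) , fibre⇒≡ {key} {p} (proj₁ (T-∧⁻ {fibre key p u} G₃))

  ⊲-pairs : sumᶠ n (λ u → countᶠ n (u ⊲_))
            ≡ sumBelow (suc k) (λ p → countᶠ n (fibre upper p) * countᶠ n (fibre lower p))
  ⊲-pairs = trans (sumᶠ-by-fibres n (suc k) upper _ λ u k<upper → contradiction (countᶠ≤ k _) (<⇒≱ k<upper))
                  (sumᶠ-cong (suc k) λ p → per-fibre (toℕ p))
    where
    pointwise : ∀ p u v → ⟦ upper u ≡ᵇ p ⟧ * ⟦ u ⊲ v ⟧ ≡ ⟦ fibre upper p u ⟧ * ⟦ fibre lower p v ⟧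
    pointwise p u v = begin
      ⟦ upper u ≡ᵇ p ⟧ * ⟦ outC u ∧ outC v ∧ (lower v ≡ᵇ upper u) ⟧
        ≡⟨ ⟦≡ᵇ⟧*-subst (upper u) p (λ a → ⟦ outC u ∧ outC v ∧ (lower v ≡ᵇ a) ⟧) ⟩
      ⟦ upper u ≡ᵇ p ⟧ * ⟦ outC u ∧ fibre lower p v ⟧
        ≡⟨ cong (⟦ upper u ≡ᵇ p ⟧ *_) (⟦∧⟧ (outC u) _) ⟩
      ⟦ upper u ≡ᵇ p ⟧ * (⟦ outC u ⟧ * ⟦ fibre lower p v ⟧)
        ≡⟨ rearrange ⟦ upper u ≡ᵇ p ⟧ ⟦ outC u ⟧ ⟦ fibre lower p v ⟧ ⟩
      ⟦ outC u ⟧ * ⟦ upper u ≡ᵇ p ⟧ * ⟦ fibre lower p v ⟧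
        ≡⟨ cong (_* ⟦ fibre lower p v ⟧) (⟦∧⟧ (outC u) _) ⟨
      ⟦ fibre upper p u ⟧ * ⟦ fibre lower p v ⟧ ∎
      where
      open ≡-Reasoning
      rearrange : ∀ e o b → e * (o * b) ≡ o * e * b
      rearrange = solve-∀
    per-fibre : ∀ p → sumᶠ n (λ u → ⟦ upper u ≡ᵇ p ⟧ * countᶠ n (u ⊲_))
                      ≡ countᶠ n (fibre upper p) * countᶠ n (fibre lower p)
    per-fibre p = begin
      sumᶠ n (λ u → ⟦ upper u ≡ᵇ p ⟧ * countᶠ n (u ⊲_))
        ≡⟨ sumᶠ-cong n (λ u → trans (*-distribˡ-sumᶠ n ⟦ upper u ≡ᵇ p ⟧ (λ v → ⟦ u ⊲ v ⟧)) (sumᶠ-cong n (pointwise p u))) ⟩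
      sumᶠ n (λ u → sumᶠ n (λ v → ⟦ fibre upper p u ⟧ * ⟦ fibre lower p v ⟧))
        ≡⟨ sumᶠ-cong n (λ u → *-distribˡ-sumᶠ n ⟦ fibre upper p u ⟧ (λ v → ⟦ fibre lower p v ⟧)) ⟨
      sumᶠ n (λ u → ⟦ fibre upper p u ⟧ * countᶠ n (fibre lower p))
        ≡⟨ *-distribʳ-sumᶠ n (countᶠ n (fibre lower p)) (λ u → ⟦ fibre upper p u ⟧) ⟨
      countᶠ n (fibre upper p) * countᶠ n (fibre lower p) ∎
      where open ≡-Reasoning

  q'''≤⊲-pairs : q''' ≤ 2 * sumᶠ n (λ u → countᶠ n (u ⊲_))
  q'''≤⊲-pairs = begin
    q'''
      ≤⟨ sumᶠ-mono-≤ n (λ u → sumᶠ-mono-≤ n λ v → ≤-trans (⟦∧⟧≤ʳ (lt u v) _) (Q'''⇒⊲ u v)) ⟩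
    sumᶠ n (λ u → sumᶠ n (λ v → ⟦ u ⊲ v ⟧ + ⟦ v ⊲ u ⟧))
      ≡⟨ trans (sumᶠ-cong n λ u → sumᶠ-distrib-+ n (λ v → ⟦ u ⊲ v ⟧) (λ v → ⟦ v ⊲ u ⟧))
               (sumᶠ-distrib-+ n _ _) ⟩
    D + sumᶠ n (λ u → sumᶠ n (λ v → ⟦ v ⊲ u ⟧))
      ≡⟨ cong (D +_) (sumᶠ-comm n n (λ u v → ⟦ v ⊲ u ⟧)) ⟩
    D + D
      ≡⟨ cong (D +_) (+-identityʳ D) ⟨
    2 * D ∎
    where
    open ≤-Reasoning
    D = sumᶠ n (λ u → countᶠ n (u ⊲_))

  q'''-bound : q''' ≤ 48 * (sumᶠ (suc k) t''ᵢ + sumᶠ (suc k) nᵢ)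
  q'''-bound = begin
    q'''
      ≤⟨ q'''≤⊲-pairs ⟩
    2 * sumᶠ n (λ u → countᶠ n (u ⊲_))
      ≡⟨ cong (2 *_) ⊲-pairs ⟩
    2 * sumBelow (suc k) (λ p → α p * β p)
      ≡⟨ *-distribˡ-sumᶠ (suc k) 2 (λ p → α (toℕ p) * β (toℕ p)) ⟩
    sumBelow (suc k) (λ p → 2 * (α p * β p))
      ≤⟨ sumᶠ-mono-≤ (suc k) (λ p → 2mn≤m²+n² (α (toℕ p)) (β (toℕ p))) ⟩
    sumBelow (suc k) (λ p → α p * α p + β p * β p)
      ≤⟨ sumᶠ-mono-≤ (suc k) (λ p → +-mono-≤ (upper-fibre-bound (toℕ p)) (lower-fibre-bound (toℕ p))) ⟩
    sumBelow (suc k) (λ p → 24 * (nWithin (A p) + t''Within (A p)) + 24 * (nWithin (B p) + t''Within (B p)))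
      ≡⟨ trans (sumᶠ-distrib-+ (suc k) (λ p → 24 * (nWithin (A (toℕ p)) + t''Within (A (toℕ p))))
                                       (λ p → 24 * (nWithin (B (toℕ p)) + t''Within (B (toℕ p)))))
               (cong₂ _+_ (scale (λ p → nWithin (A p)) (λ p → t''Within (A p)))
                                                        (scale (λ p → nWithin (B p)) (λ p → t''Within (B p)))) ⟩
    24 * (sumBelow (suc k) (λ p → nWithin (A p)) + sumBelow (suc k) (λ p → t''Within (A p)))
      + 24 * (sumBelow (suc k) (λ p → nWithin (B p)) + sumBelow (suc k) (λ p → t''Within (B p)))
      ≤⟨ +-mono-≤ (*-monoʳ-≤ 24 (+-mono-≤ (fibres-nWithin upper upper≤k) (fibres-t''Within upper upper≤k)))
                  (*-monoʳ-≤ 24 (+-mono-≤ (fibres-nWithin lower lower≤k) (fibres-t''Within lower lower≤k))) ⟩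
    24 * (N + T'') + 24 * (N + T'')
      ≡⟨ double N T'' ⟩
    48 * (T'' + N) ∎
    where
    open ≤-Reasoning
    A B : ℕ → Fin n → Bool
    A = fibre upper
    B = fibre lower
    α β : ℕ → ℕ
    α p = countᶠ n (A p)
    β p = countᶠ n (B p)
    N = sumᶠ (suc k) nᵢ
    T'' = sumᶠ (suc k) t''ᵢ
    upper≤k : ∀ x → upper x ≤ k
    upper≤k x = countᶠ≤ k _
    lower≤k : ∀ x → lower x ≤ k
    lower≤k x = countᶠ≤ k _
    double : ∀ N T → 24 * (N + T) + 24 * (N + T) ≡ 48 * (T + N)
    double = solve-∀
    scale : ∀ f g → sumBelow (suc k) (λ p → 24 * (f p + g p)) ≡ 24 * (sumBelow (suc k) f + sumBelow (suc k) g)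
    scale f g = trans (sym (*-distribˡ-sumᶠ (suc k) 24 (λ p → f (toℕ p) + g (toℕ p))))
                      (cong (24 *_) (sumᶠ-distrib-+ (suc k) (f ∘ toℕ) (g ∘ toℕ)))

lemma3p9 : (n : ℕ) (_≼_ : Rel (Fin n) 0ℓ) (po : IsDecPartialOrder _≡_ _≼_)
           (k : ℕ) (c : Fin k → Fin n) → IsLongestChain _≼_ k c →
           Counts.q''' (IsDecPartialOrder._≤?_ po) c
             ≤ 96 * (sumᶠ (suc k) (Counts.t''ᵢ (IsDecPartialOrder._≤?_ po) c)
                     + sumᶠ (suc k) (Counts.nᵢ (IsDecPartialOrder._≤?_ po) c))
lemma3p9 n _≼_ po k c longest =
  ≤-trans (LongestChain.q'''-bound po c longest) (*-monoˡ-≤ (sumᶠ (suc k) t''ᵢ + sumᶠ (suc k) nᵢ) (m≤m+n 48 48))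
  where open Counts (IsDecPartialOrder._≤?_ po) c
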